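{- Suppose $a_k=A$, $b_k=B$, $\lambda_k=C$ for all $k\ge0$. Then for every $n\ge0$, \[ \det(\mu_{i+j})_{i,j=0}^n=(A^2+AB+C)^{\binom{n+1}{2}}, \] where $\mu_k=\mathcal{L}(x^k)$.
   Context: Let $A,B,C$ be complex numbers with $A\neq 0$. Define monic polynomials $P_n(x)$ by $P_{ -1}(x)=0$, $P_0(x)=1$ and $P_{n+1}(x)=(x-B)P_n(x)-(Ax+C)P_{n-1}(x)$ for $n\ge0$, and assume $P_n(-C/A)\neq0$ for all $n\ge1$. Let $d_m(x)=(Ax+C)^m$ and $Q_m(x)=P_m(x)/d_m(x)$. Let $V=\mathrm{span}\{x^nQ_m(x):n,m\ge0\}$ (rational functions) and let $\mathcal{L}$ be the unique linear functional on $V$ with $\mathcal{L}(1)=1$ and $\mathcal{L}(x^nQ_m(x))=0$ whenever $0\le n<m$. -}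

module Defs where

open import Level using (Level; _⊔_) renaming (suc to lsuc)
open import Algebra.Bundles using (CommutativeRing)
open import Data.Nat using (ℕ; zero; suc; _∸_; _<_; _≤_) renaming (_+_ to _+ℕ_; _⊔_ to _⊔ℕ_)
open import Data.Fin using (Fin; zero; suc; toℕ; punchIn)
open import Data.List using (List; []; _∷_; foldr; map; replicate; _++_)
open import Data.Product using (_×_; _,_)
open import Relation.Nullary using (¬_)

-- A field: a commutative ring with 0 ≠ 1 in which every nonzero element has
-- a multiplicative inverse.  (Stand-in for ℂ, which agda-stdlib lacks.)
record Field (c ℓ : Level) : Set (lsuc (c ⊔ ℓ)) where
  field
    commutativeRing : CommutativeRing c ℓ
  open CommutativeRing commutativeRing public
  field
    0≉1         : ¬ (0# ≈ 1#)
    inv         : (x : Carrier) → ¬ (x ≈ 0#) → Carrier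
    inv-inverse : (x : Carrier) (x≉0 : ¬ (x ≈ 0#)) → x * inv x x≉0 ≈ 1#

module FieldDefs {c ℓ : Level} (F : Field c ℓ) where
  open Field F using (Carrier; _≈_; _+_; _*_; -_; 0#; 1#)

  pow : Carrier → ℕ → Carrier
  pow a zero    = 1#
  pow a (suc n) = a * pow a n

  -- Polynomials as coefficient lists (constant term first)
  Poly : Set c
  Poly = List Carrier

  coeff : Poly → ℕ → Carrier
  coeff []      k       = 0#
  coeff (a ∷ p) zero    = a
  coeff (a ∷ p) (suc k) = coeff p k

  IsZeroPoly : Poly → Set ℓ
  IsZeroPoly p = ∀ k → coeff p k ≈ 0#

  _⊕_ : Poly → Poly → Poly
  []      ⊕ q       = q
  (a ∷ p) ⊕ []      = a ∷ p
  (a ∷ p) ⊕ (b ∷ q) = (a + b) ∷ (p ⊕ q)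

  scale : Carrier → Poly → Poly
  scale a p = map (a *_) p

  _⊗_ : Poly → Poly → Poly
  []      ⊗ q = []
  (a ∷ p) ⊗ q = scale a q ⊕ (0# ∷ (p ⊗ q))

  shift : ℕ → Poly → Poly
  shift n p = replicate n 0# ++ p

  eval : Poly → Carrier → Carrier
  eval p x = foldr (λ a acc → a + x * acc) 0# p

  polyPow : Poly → ℕ → Poly
  polyPow p zero    = 1# ∷ []
  polyPow p (suc m) = p ⊗ polyPow p m

  module Setting (A B C : Carrier) where

    dPoly : Poly
    dPoly = C ∷ A ∷ []

    dPow : ℕ → Poly
    dPow m = polyPow dPoly m

    xMinusB : Poly
    xMinusB = (- B) ∷ 1# ∷ []

    -- P_n :  P_{-1} = 0, P_0 = 1,
    -- P_{n+1} = (x - B) P_n - (A x + C) P_{n-1}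
    -- (so P_1 = x - B, since P_{-1} = 0)
    Pol : ℕ → Poly
    Pol zero          = 1# ∷ []
    Pol (suc zero)    = xMinusB
    Pol (suc (suc n)) = (xMinusB ⊗ Pol (suc n)) ⊕ scale (- 1#) (dPoly ⊗ Pol n)

    -- A formal finite linear combination  Σ c_i · x^{n_i} Q_{m_i}(x)
    -- is a list of triples (c_i , n_i , m_i).
    Comb : Set c
    Comb = List (Carrier × ℕ × ℕ)

    maxDen : Comb → ℕ
    maxDen = foldr (λ { (_ , _ , m) acc → m ⊔ℕ acc }) 0

    -- numerator of the combination over the common denominator d^M, M = maxDen:
    --   Σ c_i x^{n_i} P_{m_i}(x) d(x)^{M - m_i}
    numerAt : ℕ → Comb → Poly
    numerAt M = foldr (λ { (a , n , m) acc → scale a (shift n (Pol m ⊗ dPow (M ∸ m))) ⊕ acc }) []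

    numer : Comb → Poly
    numer cs = numerAt (maxDen cs) cs

    -- the combination is the zero rational function
    -- (d^M ≠ 0 since A ≠ 0, so this is equivalent to numer cs being zero)
    IsZeroComb : Comb → Set ℓ
    IsZeroComb cs = IsZeroPoly (numer cs)

    -- A linear functional on V = span{x^n Q_m} is determined by its values
    -- L n m = 𝓛(x^n Q_m); it is well defined (and then linear) iff every
    -- vanishing combination is sent to 0.
    applyComb : (ℕ → ℕ → Carrier) → Comb → Carrier
    applyComb L = foldr (λ { (a , n , m) acc → a * L n m + acc }) 0#

    IsWellDefinedLinear : (ℕ → ℕ → Carrier) → Set (c ⊔ ℓ)
    IsWellDefinedLinear L = ∀ cs → IsZeroComb cs → applyComb L cs ≈ 0#

    -- 𝓛 is the functional of the paper: linear on V, 𝓛(1) = 1,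
    -- 𝓛(x^n Q_m) = 0 for 0 ≤ n < m.   (1 = x^0 Q_0.)
    record IsMomentFunctional (L : ℕ → ℕ → Carrier) : Set (c ⊔ ℓ) where
      field
        linear     : IsWellDefinedLinear L
        normalised : L 0 0 ≈ 1#
        orthogonal : ∀ n m → n < m → L n m ≈ 0#

    -- moments μ_k = 𝓛(x^k) = 𝓛(x^k Q_0)
    moment : (ℕ → ℕ → Carrier) → ℕ → Carrier
    moment L k = L k 0

  sign : ℕ → Carrier
  sign zero    = 1#
  sign (suc n) = - sign n

  sumFin : ∀ n → (Fin n → Carrier) → Carrier
  sumFin zero    f = 0#
  sumFin (suc n) f = f zero + sumFin n (λ i → f (suc i))

  det : ∀ n → (Fin n → Fin n → Carrier) → Carrier
  det zero    M = 1#
  det (suc n) M =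
    sumFin (suc n) (λ j → sign (toℕ j) * (M zero j * det n (λ i k → M (suc i) (punchIn j k))))

  hankel : (ℕ → Carrier) → ∀ n → Fin (suc n) → Fin (suc n) → Carrier
  hankel μ n i j = μ (toℕ i +ℕ toℕ j)

module Submission where

open import Level using (Level)
open import Algebra.Bundles using (CommutativeRing)
open import Data.Bool using (if_then_else_)
open import Data.Empty using (⊥-elim)
open import Data.Fin as Fin using (Fin; zero; suc; toℕ; punchIn; fromℕ<)
open import Data.Fin.Properties using (suc-injective; punchInᵢ≢i; toℕ-injective; toℕ<n; toℕ-fromℕ<; toℕ≤pred[n])
open import Data.Integer as ℤ using (ℤ; +_; -[1+_]; _⊖_; _◃_; ∣_∣)
open import Data.Integer.Properties as ℤ using ([1+m]⊖[1+n]≡m⊖n; +◃n≡+n)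
open import Data.List using (List; []; _∷_)
open import Data.Maybe using (Maybe; just; nothing)
open import Data.Nat as ℕ using (ℕ; zero; suc; _<_; _≤_; _<?_; z≤n; s≤s; _⊔_)
import Data.Nat.Properties as ℕ
open import Data.Nat.Combinatorics using (nC1≡n; nCk+nC[k+1]≡[n+1]C[k+1]) renaming (_C_ to _choose_)
open import Data.Product using (_,_)
open import Data.Sign as Sign using (Sign)
open import Data.Vec.Functional using (updateAt)
open import Data.Vec.Functional.Properties using (updateAt-updates; updateAt-minimal; updateAt-id-local)
open import Function using (_∘_; const)
open import Relation.Binary.PropositionalEquality as ≡ using (_≡_; _≢_)
import Relation.Binary.Reasoning.Setoid
open import Relation.Nullary using (¬_; Dec; yes; no; does)
open import Relation.Nullary.Decidable using (dec-true; dec-false)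
open import Defs

-- The values L n m = 𝓛(xⁿ Q_m) vanish for n < m, equal 1 on the diagonal, and
-- inherit from the three-term recurrence of the P_m a recurrence in (n, m).
-- For the row polynomials N_k(x) = Σⱼ L k j xʲ this recurrence relates N_{k+1}
-- to N_k; after the substitution x ↦ x + A it matches the recurrence of
-- H_k(x) = Σₘ motzkin k m xᵐ, the weighted Motzkin numbers of the Jacobi matrix
-- with b₀ = A + B, bₘ = 2A + B and all λₘ = Λ = A² + AB + C, through the
-- invariant (x + A) H_k(x) = A μ_k + x N_k(x + A).  Its constant term gives
-- μ_k = motzkin k 0, so the Hankel matrix factors as T D Tᵀ with
-- T = (motzkin i m) unit lower triangular and D = diag(Λᵐ), and its
-- determinant is Λ^(0 + 1 + ⋯ + n) = Λ^C(n+1,2).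

-- Coefficients are integers, mapped canonically into R: with coefficients in R
-- itself the normaliser could not see that x − x vanishes.
module IntegerRingSolver {c ℓ : Level} (R : CommutativeRing c ℓ) where
  open CommutativeRing R
  open import Algebra.Properties.Ring ring using (-‿distribˡ-*; -‿involutive; -‿+-comm; -0#≈0#)
  open import Algebra.Properties.Semiring.Mult.TCOptimised semiring using (_×_; ×-homo-+; ×1-homo-*)
  open import Algebra.Solver.Ring.AlmostCommutativeRing
  open import Relation.Binary.Reasoning.Setoid setoid

  ⟦_⟧ℤ : ℤ → Carrier
  ⟦ + n ⟧ℤ      = n × 1#
  ⟦ -[1+ n ] ⟧ℤ = - (suc n × 1#)

  ⊖-homo : ∀ m n → ⟦ m ⊖ n ⟧ℤ ≈ m × 1# + - (n × 1#)
  ⊖-homo m       zero    = trans (sym (+-identityʳ _)) (+-congˡ (sym -0#≈0#))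
  ⊖-homo zero    (suc n) = sym (+-identityˡ _)
  ⊖-homo (suc m) (suc n) = begin
    ⟦ suc m ⊖ suc n ⟧ℤ                     ≡⟨ ≡.cong ⟦_⟧ℤ ([1+m]⊖[1+n]≡m⊖n m n) ⟩
    ⟦ m ⊖ n ⟧ℤ                             ≈⟨ ⊖-homo m n ⟩
    m × 1# + - (n × 1#)                    ≈⟨ sym (cancel-1 (m × 1#) (n × 1#)) ⟩
    (1# + m × 1#) + - (1# + n × 1#)        ≈⟨ sym (+-cong (×-homo-+ 1# 1 m) (-‿cong (×-homo-+ 1# 1 n))) ⟩
    suc m × 1# + - (suc n × 1#)            ∎
    where
    cancel-1 : ∀ x y → (1# + x) + - (1# + y) ≈ x + - y
    cancel-1 x y = begin
      (1# + x) + - (1# + y)    ≈⟨ +-congˡ (sym (-‿+-comm 1# y)) ⟩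
      (1# + x) + (- 1# + - y)  ≈⟨ +-assoc 1# x _ ⟩
      1# + (x + (- 1# + - y))  ≈⟨ +-congˡ (trans (sym (+-assoc x _ _)) (+-congʳ (+-comm x _))) ⟩
      1# + ((- 1# + x) + - y)  ≈⟨ +-congˡ (+-assoc _ x _) ⟩
      1# + (- 1# + (x + - y))  ≈⟨ sym (+-assoc 1# _ _) ⟩
      (1# + - 1#) + (x + - y)  ≈⟨ +-congʳ (-‿inverseʳ 1#) ⟩
      0# + (x + - y)           ≈⟨ +-identityˡ _ ⟩
      x + - y                  ∎

  ⟦_⟧ₛ : Sign → Carrier
  ⟦ Sign.+ ⟧ₛ = 1#
  ⟦ Sign.- ⟧ₛ = - 1#

  ◃-homo : ∀ s n → ⟦ s ◃ n ⟧ℤ ≈ ⟦ s ⟧ₛ * (n × 1#)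
  ◃-homo s       zero    = sym (zeroʳ _)
  ◃-homo Sign.+ (suc n) = sym (*-identityˡ _)
  ◃-homo Sign.- (suc n) = trans (-‿cong (sym (*-identityˡ _))) (-‿distribˡ-* _ _)

  sign-abs-homo : ∀ i → ⟦ i ⟧ℤ ≈ ⟦ ℤ.sign i ⟧ₛ * (∣ i ∣ × 1#)
  sign-abs-homo (+ n)      = ≡.subst (λ z → ⟦ z ⟧ℤ ≈ 1# * (n × 1#)) (+◃n≡+n n) (◃-homo Sign.+ n)
  sign-abs-homo -[1+ n ]   = ◃-homo Sign.- (suc n)

  sign-*-homo : ∀ s t → ⟦ s Sign.* t ⟧ₛ ≈ ⟦ s ⟧ₛ * ⟦ t ⟧ₛ
  sign-*-homo Sign.+ t      = sym (*-identityˡ _)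
  sign-*-homo Sign.- Sign.+ = sym (*-identityʳ _)
  sign-*-homo Sign.- Sign.- = begin
    1#             ≈⟨ sym (-‿involutive 1#) ⟩
    - - 1#         ≈⟨ -‿cong (sym (*-identityˡ _)) ⟩
    - (1# * - 1#)  ≈⟨ -‿distribˡ-* 1# (- 1#) ⟩
    - 1# * - 1#    ∎

  +-homo : ∀ i j → ⟦ i ℤ.+ j ⟧ℤ ≈ ⟦ i ⟧ℤ + ⟦ j ⟧ℤ
  +-homo (+ m)      (+ n)      = ×-homo-+ 1# m n
  +-homo (+ m)      -[1+ n ]   = ⊖-homo m (suc n)
  +-homo -[1+ m ]   (+ n)      = trans (⊖-homo n (suc m)) (+-comm _ _)
  +-homo -[1+ m ]   -[1+ n ]   = begin
    - (suc (suc (m ℕ.+ n)) × 1#)            ≡⟨ ≡.cong (λ k → - (suc k × 1#)) (≡.sym (ℕ.+-suc m n)) ⟩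
    - ((suc m ℕ.+ suc n) × 1#)              ≈⟨ -‿cong (×-homo-+ 1# (suc m) (suc n)) ⟩
    - (suc m × 1# + suc n × 1#)             ≈⟨ sym (-‿+-comm _ _) ⟩
    - (suc m × 1#) + - (suc n × 1#)         ∎

  *-homo : ∀ i j → ⟦ i ℤ.* j ⟧ℤ ≈ ⟦ i ⟧ℤ * ⟦ j ⟧ℤ
  *-homo i j = begin
    ⟦ (ℤ.sign i Sign.* ℤ.sign j) ◃ (∣ i ∣ ℕ.* ∣ j ∣) ⟧ℤ
      ≈⟨ ◃-homo (ℤ.sign i Sign.* ℤ.sign j) (∣ i ∣ ℕ.* ∣ j ∣) ⟩
    ⟦ ℤ.sign i Sign.* ℤ.sign j ⟧ₛ * ((∣ i ∣ ℕ.* ∣ j ∣) × 1#)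
      ≈⟨ *-cong (sign-*-homo (ℤ.sign i) (ℤ.sign j)) (×1-homo-* ∣ i ∣ ∣ j ∣) ⟩
    (⟦ ℤ.sign i ⟧ₛ * ⟦ ℤ.sign j ⟧ₛ) * ((∣ i ∣ × 1#) * (∣ j ∣ × 1#))
      ≈⟨ interchange _ _ _ _ ⟩
    (⟦ ℤ.sign i ⟧ₛ * (∣ i ∣ × 1#)) * (⟦ ℤ.sign j ⟧ₛ * (∣ j ∣ × 1#))
      ≈⟨ sym (*-cong (sign-abs-homo i) (sign-abs-homo j)) ⟩
    ⟦ i ⟧ℤ * ⟦ j ⟧ℤ ∎
    where
    interchange : ∀ a b x y → (a * b) * (x * y) ≈ (a * x) * (b * y)
    interchange a b x y = begin
      (a * b) * (x * y)  ≈⟨ *-assoc a b _ ⟩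
      a * (b * (x * y))  ≈⟨ *-congˡ (trans (sym (*-assoc b x y)) (*-congʳ (*-comm b x))) ⟩
      a * ((x * b) * y)  ≈⟨ *-congˡ (*-assoc x b y) ⟩
      a * (x * (b * y))  ≈⟨ sym (*-assoc a x _) ⟩
      (a * x) * (b * y)  ∎

  -‿homo : ∀ i → ⟦ ℤ.- i ⟧ℤ ≈ - ⟦ i ⟧ℤ
  -‿homo (+ zero)  = sym -0#≈0#
  -‿homo (+ suc n) = refl
  -‿homo -[1+ n ]  = sym (-‿involutive _)

  ℤ⟶R : ℤ.+-*-rawRing -Raw-AlmostCommutative⟶ fromCommutativeRing R
  ℤ⟶R = record
    { ⟦_⟧ = ⟦_⟧ℤ ; +-homo = +-homo ; *-homo = *-homo ; -‿homo = -‿homo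
    ; 0-homo = refl ; 1-homo = refl }

  images-≟ : ∀ i j → Maybe (⟦ i ⟧ℤ ≈ ⟦ j ⟧ℤ)
  images-≟ i j with i ℤ.≟ j
  ... | yes i≡j = just (reflexive (≡.cong ⟦_⟧ℤ i≡j))
  ... | no _    = nothing

  open import Algebra.Solver.Ring ℤ.+-*-rawRing (fromCommutativeRing R) ℤ⟶R images-≟ public

module Polynomials {c ℓ : Level} (F : Field c ℓ) where
  open Field F hiding (zero)
  open FieldDefs F
  open import Algebra.Properties.Ring ring using (-‿distribˡ-*)
  open import Relation.Binary.Reasoning.Setoid setoid

  infix 4 _≋_
  record _≋_ (p q : Poly) : Set ℓ where
    constructor coeffwise
    field coeff-≈ : ∀ k → coeff p k ≈ coeff q k
  open _≋_ public

  ≋-refl : ∀ {p} → p ≋ p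
  ≋-refl = coeffwise λ _ → refl

  ≋-sym : ∀ {p q} → p ≋ q → q ≋ p
  ≋-sym p≋q = coeffwise λ k → sym (coeff-≈ p≋q k)

  ≋-trans : ∀ {p q r} → p ≋ q → q ≋ r → p ≋ r
  ≋-trans p≋q q≋r = coeffwise λ k → trans (coeff-≈ p≋q k) (coeff-≈ q≋r k)

  ∷-cong : ∀ {a b p q} → a ≈ b → p ≋ q → (a ∷ p) ≋ (b ∷ q)
  ∷-cong a≈b p≋q = coeffwise λ { zero → a≈b ; (suc k) → coeff-≈ p≋q k }

  ∷-injectiveʳ : ∀ {a b p q} → (a ∷ p) ≋ (b ∷ q) → p ≋ q
  ∷-injectiveʳ e = coeffwise λ k → coeff-≈ e (suc k)

  0∷[]≋[] : (0# ∷ []) ≋ []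
  0∷[]≋[] = coeffwise λ { zero → refl ; (suc k) → refl }

  coeff-⊕ : ∀ p q k → coeff (p ⊕ q) k ≈ coeff p k + coeff q k
  coeff-⊕ []      q       k       = sym (+-identityˡ _)
  coeff-⊕ (a ∷ p) []      k       = sym (+-identityʳ _)
  coeff-⊕ (a ∷ p) (b ∷ q) zero    = refl
  coeff-⊕ (a ∷ p) (b ∷ q) (suc k) = coeff-⊕ p q k

  coeff-scale : ∀ a p k → coeff (scale a p) k ≈ a * coeff p k
  coeff-scale a []      k       = sym (zeroʳ _)
  coeff-scale a (b ∷ p) zero    = refl
  coeff-scale a (b ∷ p) (suc k) = coeff-scale a p k

  ⊕-cong : ∀ {p p′ q q′} → p ≋ p′ → q ≋ q′ → (p ⊕ q) ≋ (p′ ⊕ q′)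
  ⊕-cong {p} {p′} {q} {q′} e f = coeffwise λ k → begin
    coeff (p ⊕ q) k          ≈⟨ coeff-⊕ p q k ⟩
    coeff p k + coeff q k    ≈⟨ +-cong (coeff-≈ e k) (coeff-≈ f k) ⟩
    coeff p′ k + coeff q′ k  ≈⟨ sym (coeff-⊕ p′ q′ k) ⟩
    coeff (p′ ⊕ q′) k        ∎

  scale-cong : ∀ {a b p q} → a ≈ b → p ≋ q → scale a p ≋ scale b q
  scale-cong {a} {b} {p} {q} a≈b e = coeffwise λ k →
    trans (coeff-scale a p k) (trans (*-cong a≈b (coeff-≈ e k)) (sym (coeff-scale b q k)))

  ⊕-comm : ∀ p q → (p ⊕ q) ≋ (q ⊕ p)
  ⊕-comm p q = coeffwise λ k → trans (coeff-⊕ p q k) (trans (+-comm _ _) (sym (coeff-⊕ q p k)))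

  ⊕-assoc : ∀ p q r → ((p ⊕ q) ⊕ r) ≋ (p ⊕ (q ⊕ r))
  ⊕-assoc p q r = coeffwise λ k → begin
    coeff ((p ⊕ q) ⊕ r) k                ≈⟨ trans (coeff-⊕ (p ⊕ q) r k) (+-congʳ (coeff-⊕ p q k)) ⟩
    (coeff p k + coeff q k) + coeff r k  ≈⟨ +-assoc _ _ _ ⟩
    coeff p k + (coeff q k + coeff r k)  ≈⟨ sym (trans (coeff-⊕ p (q ⊕ r) k) (+-congˡ (coeff-⊕ q r k))) ⟩
    coeff (p ⊕ (q ⊕ r)) k                ∎

  ⊕-interchange : ∀ p q r s → ((p ⊕ q) ⊕ (r ⊕ s)) ≋ ((p ⊕ r) ⊕ (q ⊕ s))
  ⊕-interchange p q r s = coeffwise λ k → begin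
    coeff ((p ⊕ q) ⊕ (r ⊕ s)) k
      ≈⟨ trans (coeff-⊕ (p ⊕ q) (r ⊕ s) k) (+-cong (coeff-⊕ p q k) (coeff-⊕ r s k)) ⟩
    (coeff p k + coeff q k) + (coeff r k + coeff s k)
      ≈⟨ solve 4 (λ a b c d → (a :+ b) :+ (c :+ d) := (a :+ c) :+ (b :+ d)) refl _ _ _ _ ⟩
    (coeff p k + coeff r k) + (coeff q k + coeff s k)
      ≈⟨ sym (trans (coeff-⊕ (p ⊕ r) (q ⊕ s) k) (+-cong (coeff-⊕ p r k) (coeff-⊕ q s k))) ⟩
    coeff ((p ⊕ r) ⊕ (q ⊕ s)) k ∎
    where open IntegerRingSolver commutativeRing using (solve; _:=_; _:+_)

  ⊕-identityʳ : ∀ p → (p ⊕ []) ≋ p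
  ⊕-identityʳ []      = ≋-refl
  ⊕-identityʳ (a ∷ p) = ≋-refl

  negate : Poly → Poly
  negate = scale (- 1#)

  negate-inverseˡ : ∀ p → (negate p ⊕ p) ≋ []
  negate-inverseˡ p = coeffwise λ k → begin
    coeff (negate p ⊕ p) k          ≈⟨ trans (coeff-⊕ (negate p) p k) (+-congʳ (coeff-scale _ p k)) ⟩
    - 1# * coeff p k + coeff p k    ≈⟨ +-congʳ (trans (sym (-‿distribˡ-* _ _)) (-‿cong (*-identityˡ _))) ⟩
    - coeff p k + coeff p k         ≈⟨ -‿inverseˡ _ ⟩
    0#                              ∎

  scale-⊕ : ∀ a p q → scale a (p ⊕ q) ≋ (scale a p ⊕ scale a q)
  scale-⊕ a p q = coeffwise λ k → begin
    coeff (scale a (p ⊕ q)) k                 ≈⟨ trans (coeff-scale a (p ⊕ q) k) (*-congˡ (coeff-⊕ p q k)) ⟩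
    a * (coeff p k + coeff q k)               ≈⟨ distribˡ _ _ _ ⟩
    a * coeff p k + a * coeff q k             ≈⟨ sym (trans (coeff-⊕ (scale a p) (scale a q) k) (+-cong (coeff-scale a p k) (coeff-scale a q k))) ⟩
    coeff (scale a p ⊕ scale a q) k           ∎

  scale-+ : ∀ a b p → scale (a + b) p ≋ (scale a p ⊕ scale b p)
  scale-+ a b p = coeffwise λ k → begin
    coeff (scale (a + b) p) k        ≈⟨ trans (coeff-scale (a + b) p k) (distribʳ _ _ _) ⟩
    a * coeff p k + b * coeff p k    ≈⟨ sym (trans (coeff-⊕ (scale a p) (scale b p) k) (+-cong (coeff-scale a p k) (coeff-scale b p k))) ⟩
    coeff (scale a p ⊕ scale b p) k  ∎

  scale-scale : ∀ a b p → scale a (scale b p) ≋ scale (a * b) p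
  scale-scale a b p = coeffwise λ k →
    trans (coeff-scale a (scale b p) k) (trans (*-congˡ (coeff-scale b p k)) (trans (sym (*-assoc _ _ _)) (sym (coeff-scale _ p k))))

  scale-identity : ∀ p → scale 1# p ≋ p
  scale-identity p = coeffwise λ k → trans (coeff-scale 1# p k) (*-identityˡ _)

  scale-zero : ∀ p → scale 0# p ≋ []
  scale-zero p = coeffwise λ k → trans (coeff-scale 0# p k) (zeroˡ _)

  ⊗-zeroʳ : ∀ p → (p ⊗ []) ≋ []
  ⊗-zeroʳ []      = ≋-refl
  ⊗-zeroʳ (a ∷ p) = ≋-trans (∷-cong refl (⊗-zeroʳ p)) 0∷[]≋[]

  ⊗-zeroˡ : ∀ {p} q → p ≋ [] → (p ⊗ q) ≋ []
  ⊗-zeroˡ {[]}    q e = ≋-refl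
  ⊗-zeroˡ {a ∷ p} q e =
    ≋-trans (⊕-cong (≋-trans (scale-cong (coeff-≈ e zero) ≋-refl) (scale-zero q))
                    (∷-cong refl (⊗-zeroˡ q (∷-injectiveʳ (≋-trans e (≋-sym 0∷[]≋[]))))))
            0∷[]≋[]

  ⊗-congˡ : ∀ p {q q′} → q ≋ q′ → (p ⊗ q) ≋ (p ⊗ q′)
  ⊗-congˡ []      e = ≋-refl
  ⊗-congˡ (a ∷ p) e = ⊕-cong (scale-cong refl e) (∷-cong refl (⊗-congˡ p e))

  ⊗-congʳ : ∀ {p p′} q → p ≋ p′ → (p ⊗ q) ≋ (p′ ⊗ q)
  ⊗-congʳ {[]}    q e = ≋-sym (⊗-zeroˡ q (≋-sym e))
  ⊗-congʳ {a ∷ p} {[]}     q e = ⊗-zeroˡ q e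
  ⊗-congʳ {a ∷ p} {b ∷ p′} q e =
    ⊕-cong (scale-cong (coeff-≈ e zero) ≋-refl) (∷-cong refl (⊗-congʳ q (∷-injectiveʳ e)))

  ⊗-cong : ∀ {p p′ q q′} → p ≋ p′ → q ≋ q′ → (p ⊗ q) ≋ (p′ ⊗ q′)
  ⊗-cong {p′ = p′} {q = q} e f = ≋-trans (⊗-congʳ q e) (⊗-congˡ p′ f)

  0∷-⊕ : ∀ p q → (0# ∷ (p ⊕ q)) ≋ ((0# ∷ p) ⊕ (0# ∷ q))
  0∷-⊕ p q = ∷-cong (sym (+-identityˡ _)) ≋-refl

  ⊗-distribˡ : ∀ p q r → (p ⊗ (q ⊕ r)) ≋ ((p ⊗ q) ⊕ (p ⊗ r))
  ⊗-distribˡ []      q r = ≋-refl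
  ⊗-distribˡ (a ∷ p) q r =
    ≋-trans (⊕-cong (scale-⊕ a q r) (≋-trans (∷-cong refl (⊗-distribˡ p q r)) (0∷-⊕ (p ⊗ q) (p ⊗ r))))
            (⊕-interchange (scale a q) (scale a r) (0# ∷ (p ⊗ q)) (0# ∷ (p ⊗ r)))

  ⊗-distribʳ : ∀ p q r → ((q ⊕ r) ⊗ p) ≋ ((q ⊗ p) ⊕ (r ⊗ p))
  ⊗-distribʳ p []      r       = ≋-refl
  ⊗-distribʳ p (a ∷ q) []      = ≋-sym (⊕-identityʳ _)
  ⊗-distribʳ p (a ∷ q) (b ∷ r) =
    ≋-trans (⊕-cong (scale-+ a b p) (≋-trans (∷-cong refl (⊗-distribʳ p q r)) (0∷-⊕ (q ⊗ p) (r ⊗ p))))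
            (⊕-interchange (scale a p) (scale b p) (0# ∷ (q ⊗ p)) (0# ∷ (r ⊗ p)))

  scale-⊗ : ∀ a p q → (scale a p ⊗ q) ≋ scale a (p ⊗ q)
  scale-⊗ a []      q = ≋-refl
  scale-⊗ a (b ∷ p) q =
    ≋-trans (⊕-cong (≋-sym (scale-scale a b q)) (∷-cong (sym (zeroʳ a)) (scale-⊗ a p q)))
            (≋-sym (scale-⊕ a (scale b q) (0# ∷ (p ⊗ q))))

  0∷-⊗ : ∀ p q → ((0# ∷ p) ⊗ q) ≋ (0# ∷ (p ⊗ q))
  0∷-⊗ p q = ⊕-cong (scale-zero q) ≋-refl

  ⊗-0∷ : ∀ p q → (p ⊗ (0# ∷ q)) ≋ (0# ∷ (p ⊗ q))
  ⊗-0∷ []      q = ≋-sym 0∷[]≋[]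
  ⊗-0∷ (a ∷ p) q = ∷-cong (trans (+-identityʳ _) (zeroʳ a)) (⊕-cong ≋-refl (⊗-0∷ p q))

  ⊗-constʳ : ∀ a p → (p ⊗ (a ∷ [])) ≋ scale a p
  ⊗-constʳ a []      = ≋-refl
  ⊗-constʳ a (b ∷ p) = ∷-cong (trans (+-identityʳ _) (*-comm _ _)) (⊗-constʳ a p)

  ⊗-constˡ : ∀ a p → ((a ∷ []) ⊗ p) ≋ scale a p
  ⊗-constˡ a p = ≋-trans (⊕-cong ≋-refl 0∷[]≋[]) (⊕-identityʳ _)

  ⊗-comm : ∀ p q → (p ⊗ q) ≋ (q ⊗ p)
  ⊗-comm []      q = ≋-sym (⊗-zeroʳ q)
  ⊗-comm (a ∷ p) q = ≋-sym
    (≋-trans (⊗-congˡ q (∷-cong (sym (+-identityʳ a)) ≋-refl))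
    (≋-trans (⊗-distribˡ q (a ∷ []) (0# ∷ p))
             (⊕-cong (⊗-constʳ a q) (≋-trans (⊗-0∷ q p) (∷-cong refl (⊗-comm q p))))))

  ⊗-assoc : ∀ p q r → ((p ⊗ q) ⊗ r) ≋ (p ⊗ (q ⊗ r))
  ⊗-assoc []      q r = ≋-refl
  ⊗-assoc (a ∷ p) q r =
    ≋-trans (⊗-distribʳ r (scale a q) (0# ∷ (p ⊗ q)))
            (⊕-cong (scale-⊗ a q r) (≋-trans (0∷-⊗ (p ⊗ q) r) (∷-cong refl (⊗-assoc p q r))))

  ⊗-identityˡ : ∀ p → ((1# ∷ []) ⊗ p) ≋ p
  ⊗-identityˡ p = ≋-trans (⊗-constˡ 1# p) (scale-identity p)

  polyRing : CommutativeRing c ℓ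
  polyRing = record
    { Carrier = Poly ; _≈_ = _≋_ ; _+_ = _⊕_ ; _*_ = _⊗_ ; -_ = negate ; 0# = [] ; 1# = 1# ∷ []
    ; isCommutativeRing = record
      { isRing = record
        { +-isAbelianGroup = record
          { isGroup = record
            { isMonoid = record
              { isSemigroup = record
                { isMagma = record
                  { isEquivalence = record { refl = ≋-refl ; sym = ≋-sym ; trans = ≋-trans }
                  ; ∙-cong = ⊕-cong }
                ; assoc = ⊕-assoc }
              ; identity = (λ _ → ≋-refl) , ⊕-identityʳ }
            ; inverse = negate-inverseˡ , (λ p → ≋-trans (⊕-comm p (negate p)) (negate-inverseˡ p))
            ; ⁻¹-cong = scale-cong refl }
          ; comm = ⊕-comm }
        ; *-cong = ⊗-cong
        ; *-assoc = ⊗-assoc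
        ; *-identity = ⊗-identityˡ , (λ p → ≋-trans (⊗-comm p _) (⊗-identityˡ p))
        ; distrib = ⊗-distribˡ , ⊗-distribʳ }
      ; *-comm = ⊗-comm } }

  K : Carrier → Poly
  K a = a ∷ []

  X : Poly
  X = 0# ∷ 1# ∷ []

  X^ : ℕ → Poly
  X^ n = shift n (1# ∷ [])

  X⊗ : ∀ p → (X ⊗ p) ≋ (0# ∷ p)
  X⊗ p = ≋-trans (0∷-⊗ (1# ∷ []) p) (∷-cong refl (⊗-identityˡ p))

  shift≋X^⊗ : ∀ n p → shift n p ≋ (X^ n ⊗ p)
  shift≋X^⊗ zero    p = ≋-sym (⊗-identityˡ p)
  shift≋X^⊗ (suc n) p = ≋-trans (∷-cong refl (shift≋X^⊗ n p)) (≋-sym (0∷-⊗ (X^ n) p))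

  X^-suc : ∀ n → X^ (suc n) ≋ (X ⊗ X^ n)
  X^-suc n = ≋-sym (X⊗ (X^ n))

  scale≋K⊗ : ∀ a p → scale a p ≋ (K a ⊗ p)
  scale≋K⊗ a p = ≋-sym (⊗-constˡ a p)

  K-cong : ∀ {a b} → a ≈ b → K a ≋ K b
  K-cong a≈b = ∷-cong a≈b ≋-refl

  K-* : ∀ a b → K (a * b) ≋ (K a ⊗ K b)
  K-* a b = ∷-cong (sym (+-identityʳ _)) ≋-refl

  K-neg : ∀ a → K (- a) ≋ negate (K a)
  K-neg a = ∷-cong (trans (-‿cong (sym (*-identityˡ _))) (-‿distribˡ-* _ _)) ≋-refl

  linear≋ : ∀ a b → (a ∷ b ∷ []) ≋ (K a ⊕ (K b ⊗ X))
  linear≋ a b = coeffwise λ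
    { zero          → sym (trans (+-congˡ (trans (+-identityʳ _) (zeroʳ _))) (+-identityʳ _))
    ; (suc zero)    → sym (*-identityʳ _)
    ; (suc (suc k)) → refl }

  fromCoeffs : (ℕ → Carrier) → ℕ → Poly
  fromCoeffs f zero    = []
  fromCoeffs f (suc n) = f 0 ∷ fromCoeffs (λ j → f (suc j)) n

  coeff-fromCoeffs : ∀ f n j → (n ≤ j → f j ≈ 0#) → coeff (fromCoeffs f n) j ≈ f j
  coeff-fromCoeffs f zero    j       f≈0 = sym (f≈0 z≤n)
  coeff-fromCoeffs f (suc n) zero    f≈0 = refl
  coeff-fromCoeffs f (suc n) (suc j) f≈0 = coeff-fromCoeffs (λ j → f (suc j)) n j (λ n≤j → f≈0 (s≤s n≤j))

  -- translate a p is p(x + a), computed by Horner's scheme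
  translate : Carrier → Poly → Poly
  translate a []      = []
  translate a (b ∷ p) = K b ⊕ ((a ∷ 1# ∷ []) ⊗ translate a p)

  module _ (a : Carrier) where
    open IntegerRingSolver polyRing using (solve; _:=_; _:+_; _:*_)

    X+a≋ : (a ∷ 1# ∷ []) ≋ (X ⊕ K a)
    X+a≋ = coeffwise λ { zero → sym (+-identityˡ _) ; (suc zero) → refl ; (suc (suc k)) → refl }

    translate-[] : ∀ {p} → p ≋ [] → translate a p ≋ []
    translate-[] {[]}    e = ≋-refl
    translate-[] {b ∷ p} e =
      ⊕-cong (≋-trans (K-cong (coeff-≈ e zero)) 0∷[]≋[])
             (≋-trans (⊗-congˡ (a ∷ 1# ∷ []) (translate-[] (∷-injectiveʳ (≋-trans e (≋-sym 0∷[]≋[])))))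
                      (⊗-zeroʳ (a ∷ 1# ∷ [])))

    translate-cong : ∀ {p q} → p ≋ q → translate a p ≋ translate a q
    translate-cong {[]}    {q}     e = ≋-sym (translate-[] (≋-sym e))
    translate-cong {b ∷ p} {[]}    e = translate-[] e
    translate-cong {b ∷ p} {c ∷ q} e =
      ⊕-cong (K-cong (coeff-≈ e zero)) (⊗-congˡ (a ∷ 1# ∷ []) (translate-cong (∷-injectiveʳ e)))

    translate-K : ∀ b → translate a (K b) ≋ K b
    translate-K b = ≋-trans (⊕-cong (≋-refl {K b}) (⊗-zeroʳ (a ∷ 1# ∷ []))) (⊕-identityʳ (K b))

    translate-0∷ : ∀ p → translate a (0# ∷ p) ≋ ((X ⊕ K a) ⊗ translate a p)
    translate-0∷ p = ⊕-cong 0∷[]≋[] (⊗-congʳ (translate a p) X+a≋)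

    translate-⊕ : ∀ p q → translate a (p ⊕ q) ≋ (translate a p ⊕ translate a q)
    translate-⊕ []      q       = ≋-refl
    translate-⊕ (b ∷ p) []      = ≋-sym (⊕-identityʳ _)
    translate-⊕ (b ∷ p) (c ∷ q) =
      ≋-trans (⊕-cong (≋-refl {K b ⊕ K c}) (⊗-congˡ Y (translate-⊕ p q)))
              (solve 5 (λ kb kc y tp tq → (kb :+ kc) :+ (y :* (tp :+ tq)) := (kb :+ (y :* tp)) :+ (kc :+ (y :* tq)))
                     ≋-refl (K b) (K c) Y (translate a p) (translate a q))
      where Y = a ∷ 1# ∷ []

    translate-scale : ∀ b p → translate a (scale b p) ≋ (K b ⊗ translate a p)
    translate-scale b []      = ≋-sym (⊗-zeroʳ (K b))
    translate-scale b (c ∷ p) =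
      ≋-trans (⊕-cong (K-* b c) (⊗-congˡ Y (translate-scale b p)))
              (solve 4 (λ kb kc y tp → (kb :* kc) :+ (y :* (kb :* tp)) := kb :* (kc :+ (y :* tp)))
                     ≋-refl (K b) (K c) Y (translate a p))
      where Y = a ∷ 1# ∷ []

  module ≋-Reasoning = Relation.Binary.Reasoning.Setoid (CommutativeRing.setoid polyRing)

module Sums {c ℓ : Level} (F : Field c ℓ) where
  open Field F hiding (zero)
  open FieldDefs F
  open IntegerRingSolver commutativeRing using (solve; _:=_; _:+_)
  open import Algebra.Properties.Ring ring using (-0#≈0#; -‿+-comm)
  open import Algebra.Properties.CommutativeSemigroup +-commutativeSemigroup using (x∙yz≈y∙xz)

  sumFin-cong : ∀ n {f g : Fin n → Carrier} → (∀ i → f i ≈ g i) → sumFin n f ≈ sumFin n g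
  sumFin-cong zero    f≈g = refl
  sumFin-cong (suc n) f≈g = +-cong (f≈g zero) (sumFin-cong n (f≈g ∘ suc))

  sumFin-+ : ∀ n (f g : Fin n → Carrier) → sumFin n (λ i → f i + g i) ≈ sumFin n f + sumFin n g
  sumFin-+ zero    f g = sym (+-identityʳ _)
  sumFin-+ (suc n) f g = trans (+-congˡ (sumFin-+ n (f ∘ suc) (g ∘ suc)))
    (solve 4 (λ a b x y → (a :+ b) :+ (x :+ y) := (a :+ x) :+ (b :+ y)) refl
           (f zero) (g zero) (sumFin n (f ∘ suc)) (sumFin n (g ∘ suc)))

  *-distribˡ-sumFin : ∀ n a (f : Fin n → Carrier) → a * sumFin n f ≈ sumFin n (λ i → a * f i)
  *-distribˡ-sumFin zero    a f = zeroʳ a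
  *-distribˡ-sumFin (suc n) a f = trans (distribˡ _ _ _) (+-congˡ (*-distribˡ-sumFin n a (f ∘ suc)))

  -‿distrib-sumFin : ∀ n (f : Fin n → Carrier) → sumFin n (λ i → - f i) ≈ - sumFin n f
  -‿distrib-sumFin zero    f = sym -0#≈0#
  -‿distrib-sumFin (suc n) f = trans (+-congˡ (-‿distrib-sumFin n (f ∘ suc))) (-‿+-comm _ _)

  sumFin-zero : ∀ n {f : Fin n → Carrier} → (∀ i → f i ≈ 0#) → sumFin n f ≈ 0#
  sumFin-zero zero    f≈0 = refl
  sumFin-zero (suc n) f≈0 = trans (+-cong (f≈0 zero) (sumFin-zero n (f≈0 ∘ suc))) (+-identityʳ _)

  sumFin-punchIn : ∀ n (f : Fin (suc n) → Carrier) r → sumFin (suc n) f ≈ f r + sumFin n (f ∘ punchIn r)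
  sumFin-punchIn n       f zero    = refl
  sumFin-punchIn (suc n) f (suc r) =
    trans (+-congˡ (sumFin-punchIn n (f ∘ suc) r)) (x∙yz≈y∙xz (f zero) (f (suc r)) _)

  ∑ : ℕ → (ℕ → Carrier) → Carrier
  ∑ zero    f = 0#
  ∑ (suc K) f = f 0 + ∑ K (f ∘ suc)

  sumFin≈∑ : ∀ K (f : ℕ → Carrier) → sumFin K (f ∘ toℕ) ≈ ∑ K f
  sumFin≈∑ zero    f = refl
  sumFin≈∑ (suc K) f = +-congˡ (sumFin≈∑ K (f ∘ suc))

  ∑-cong : ∀ K {f g : ℕ → Carrier} → (∀ m → f m ≈ g m) → ∑ K f ≈ ∑ K g
  ∑-cong zero    f≈g = refl
  ∑-cong (suc K) f≈g = +-cong (f≈g 0) (∑-cong K (f≈g ∘ suc))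

  ∑-+ : ∀ K (f g : ℕ → Carrier) → ∑ K (λ m → f m + g m) ≈ ∑ K f + ∑ K g
  ∑-+ zero    f g = sym (+-identityʳ _)
  ∑-+ (suc K) f g = trans (+-congˡ (∑-+ K (f ∘ suc) (g ∘ suc)))
    (solve 4 (λ a b x y → (a :+ b) :+ (x :+ y) := (a :+ x) :+ (b :+ y)) refl (f 0) (g 0) (∑ K (f ∘ suc)) (∑ K (g ∘ suc)))

  ∑-last : ∀ K (f : ℕ → Carrier) → ∑ (suc K) f ≈ ∑ K f + f K
  ∑-last zero    f = trans (+-identityʳ _) (sym (+-identityˡ _))
  ∑-last (suc K) f = trans (+-congˡ (∑-last K (f ∘ suc))) (sym (+-assoc _ _ _))

  ∑-zero : ∀ K {f : ℕ → Carrier} → (∀ m → f m ≈ 0#) → ∑ K f ≈ 0#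
  ∑-zero zero    f≈0 = refl
  ∑-zero (suc K) f≈0 = trans (+-cong (f≈0 0) (∑-zero K (f≈0 ∘ suc))) (+-identityʳ _)

  ∏ : ℕ → (ℕ → Carrier) → Carrier
  ∏ zero    f = 1#
  ∏ (suc K) f = f 0 * ∏ K (f ∘ suc)

  ∏-last : ∀ K (f : ℕ → Carrier) → ∏ (suc K) f ≈ ∏ K f * f K
  ∏-last zero    f = trans (*-identityʳ _) (sym (*-identityˡ _))
  ∏-last (suc K) f = trans (*-congˡ (∏-last K (f ∘ suc))) (sym (*-assoc _ _ _))

  pow-+ : ∀ a m n → pow a (m ℕ.+ n) ≈ pow a m * pow a n
  pow-+ a zero    n = sym (*-identityˡ _)
  pow-+ a (suc m) n = trans (*-congˡ (pow-+ a m n)) (sym (*-assoc _ _ _))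

  ∏-pow : ∀ a K → ∏ K (pow a) ≈ pow a (K choose 2)
  ∏-pow a zero    = refl
  ∏-pow a (suc K) = begin
    ∏ (suc K) (pow a)               ≈⟨ ∏-last K (pow a) ⟩
    ∏ K (pow a) * pow a K           ≈⟨ *-congʳ (∏-pow a K) ⟩
    pow a (K choose 2) * pow a K    ≈⟨ sym (pow-+ a (K choose 2) K) ⟩
    pow a (K choose 2 ℕ.+ K)        ≡⟨ ≡.cong (pow a) exponent ⟩
    pow a (suc K choose 2)          ∎
    where
    open import Relation.Binary.Reasoning.Setoid setoid
    exponent : K choose 2 ℕ.+ K ≡ suc K choose 2
    exponent = ≡.trans (ℕ.+-comm (K choose 2) K)
                 (≡.trans (≡.cong (ℕ._+ K choose 2) (≡.sym (nC1≡n K))) (nCk+nC[k+1]≡[n+1]C[k+1] K 1))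

module Determinants {c ℓ : Level} (F : Field c ℓ) where
  open Field F hiding (zero)
  open FieldDefs F
  open import Algebra.Properties.Ring ring using (-‿involutive; -0#≈0#; -‿distribˡ-*; -‿distribʳ-*)
  open import Algebra.Properties.Group +-group using (inverseʳ-unique)
  open import Relation.Binary.Reasoning.Setoid setoid
  open IntegerRingSolver commutativeRing using (solve; _:=_; _:+_; _:*_; :-_; con)
  open Sums F

  Matrix : ℕ → Set c
  Matrix n = Fin n → Fin n → Carrier

  minor : ∀ {n} → Matrix (suc n) → Fin (suc n) → Matrix n
  minor M j i k = M (suc i) (punchIn j k)

  expansionTerm : ∀ {n} → Matrix (suc n) → Fin (suc n) → Carrier
  expansionTerm {n} M j = sign (toℕ j) * (M zero j * det n (minor M j))

  RowsAgreeExcept : ∀ {n} → Fin n → Matrix n → Matrix n → Set _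
  RowsAgreeExcept r M M′ = ∀ i → i ≢ r → ∀ j → M i j ≈ M′ i j

  det-cong : ∀ n {M M′ : Matrix n} → (∀ i j → M i j ≈ M′ i j) → det n M ≈ det n M′
  det-cong zero    M≈M′ = refl
  det-cong (suc n) M≈M′ = sumFin-cong (suc n) λ j →
    *-congˡ {sign (toℕ j)} (*-cong (M≈M′ zero j) (det-cong n (λ i k → M≈M′ (suc i) (punchIn j k))))

  det-termwise-linear : ∀ n (M M₁ M₂ : Matrix (suc n)) a →
    (∀ j → expansionTerm M j ≈ a * expansionTerm M₁ j + expansionTerm M₂ j) →
    det (suc n) M ≈ a * det (suc n) M₁ + det (suc n) M₂
  det-termwise-linear n M M₁ M₂ a terms = begin
    det (suc n) M                                                        ≈⟨ sumFin-cong (suc n) terms ⟩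
    sumFin (suc n) (λ j → a * expansionTerm M₁ j + expansionTerm M₂ j)   ≈⟨ sumFin-+ (suc n) (λ j → a * expansionTerm M₁ j) (expansionTerm M₂) ⟩
    sumFin (suc n) (λ j → a * expansionTerm M₁ j) + det (suc n) M₂       ≈⟨ +-congʳ (sym (*-distribˡ-sumFin (suc n) a (expansionTerm M₁))) ⟩
    a * det (suc n) M₁ + det (suc n) M₂                                  ∎

  det-linear : ∀ n (M M₁ M₂ : Matrix (suc n)) r a →
    RowsAgreeExcept r M₁ M → RowsAgreeExcept r M₂ M →
    (∀ j → M r j ≈ a * M₁ r j + M₂ r j) →
    det (suc n) M ≈ a * det (suc n) M₁ + det (suc n) M₂
  det-linear n M M₁ M₂ zero a M₁≈M M₂≈M Mr = det-termwise-linear n M M₁ M₂ a λ j →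
    let d₁≈d₂ = det-cong n (λ i k → trans (M₁≈M (suc i) (λ ()) (punchIn j k)) (sym (M₂≈M (suc i) (λ ()) (punchIn j k))))
        d≈d₁  = det-cong n (λ i k → sym (M₁≈M (suc i) (λ ()) (punchIn j k)))
    in begin
    expansionTerm M j
      ≈⟨ *-congˡ (*-cong (Mr j) (trans d≈d₁ d₁≈d₂)) ⟩
    sign (toℕ j) * ((a * M₁ zero j + M₂ zero j) * det n (minor M₂ j))
      ≈⟨ solve 5 (λ s a x y d → s :* ((a :* x :+ y) :* d) := a :* (s :* (x :* d)) :+ s :* (y :* d)) refl
               (sign (toℕ j)) a (M₁ zero j) (M₂ zero j) (det n (minor M₂ j)) ⟩
    a * (sign (toℕ j) * (M₁ zero j * det n (minor M₂ j))) + expansionTerm M₂ j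
      ≈⟨ +-congʳ (*-congˡ (*-congˡ (*-congˡ (sym d₁≈d₂)))) ⟩
    a * expansionTerm M₁ j + expansionTerm M₂ j ∎
  det-linear (suc n) M M₁ M₂ (suc r) a M₁≈M M₂≈M Mr = det-termwise-linear (suc n) M M₁ M₂ a λ j → begin
    expansionTerm M j
      ≈⟨ *-congˡ (*-congˡ (det-linear n (minor M j) (minor M₁ j) (minor M₂ j) r a
            (λ i i≢r k → M₁≈M (suc i) (i≢r ∘ suc-injective) (punchIn j k))
            (λ i i≢r k → M₂≈M (suc i) (i≢r ∘ suc-injective) (punchIn j k))
            (Mr ∘ punchIn j))) ⟩
    sign (toℕ j) * (M zero j * (a * det (suc n) (minor M₁ j) + det (suc n) (minor M₂ j)))
      ≈⟨ solve 5 (λ s a x d₁ d₂ → s :* (x :* (a :* d₁ :+ d₂)) := a :* (s :* (x :* d₁)) :+ s :* (x :* d₂)) refl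
               (sign (toℕ j)) a (M zero j) (det (suc n) (minor M₁ j)) (det (suc n) (minor M₂ j)) ⟩
    a * (sign (toℕ j) * (M zero j * det (suc n) (minor M₁ j))) + sign (toℕ j) * (M zero j * det (suc n) (minor M₂ j))
      ≈⟨ +-cong (*-congˡ (*-congˡ (*-congʳ (sym (M₁≈M zero (λ ()) j))))) (*-congˡ (*-congʳ (sym (M₂≈M zero (λ ()) j)))) ⟩
    a * expansionTerm M₁ j + expansionTerm M₂ j ∎

  -- The term of the pair of deleted columns (0, k+1) cancels that of (k+1, 0);
  -- the remaining terms form the same double sum one size down.
  doubleExpansion≈0 : ∀ n (u : Fin (suc (suc n)) → Carrier) (G : (Fin n → Fin (suc (suc n))) → Carrier) →
    (∀ σ τ → (∀ l → σ l ≡ τ l) → G σ ≈ G τ) →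
    sumFin (suc (suc n)) (λ j → sumFin (suc n) (λ k →
      sign (toℕ j) * (u j * (sign (toℕ k) * (u (punchIn j k) * G (punchIn j ∘ punchIn k)))))) ≈ 0#
  doubleExpansion≈0 n u G G-cong = begin
    Σ₀ + sumFin (suc n) (λ j → T (suc j) zero + sumFin n (λ k → T (suc j) (suc k)))
      ≈⟨ +-congˡ (sumFin-+ (suc n) (λ j → T (suc j) zero) (λ j → sumFin n (λ k → T (suc j) (suc k)))) ⟩
    Σ₀ + (sumFin (suc n) (λ j → T (suc j) zero) + sumFin (suc n) (λ j → sumFin n (λ k → T (suc j) (suc k))))
      ≈⟨ sym (+-assoc _ _ _) ⟩
    (Σ₀ + sumFin (suc n) (λ j → T (suc j) zero)) + sumFin (suc n) (λ j → sumFin n (λ k → T (suc j) (suc k)))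
      ≈⟨ +-cong (trans (sym (sumFin-+ (suc n) (T zero) (λ j → T (suc j) zero))) (sumFin-zero (suc n) paired))
                (inner n u G G-cong) ⟩
    0# + 0#
      ≈⟨ +-identityʳ _ ⟩
    0# ∎
    where
    T : Fin (suc (suc n)) → Fin (suc n) → Carrier
    T j k = sign (toℕ j) * (u j * (sign (toℕ k) * (u (punchIn j k) * G (punchIn j ∘ punchIn k))))
    Σ₀ = sumFin (suc n) (T zero)
    paired : ∀ k → T zero k + T (suc k) zero ≈ 0#
    paired k = solve 5 (λ a b s g o → o :* (a :* (s :* (b :* g))) :+ (:- s) :* (b :* (o :* (a :* g))) := con (ℤ.+ 0)) refl
                 (u zero) (u (suc k)) (sign (toℕ k)) (G (suc ∘ punchIn k)) 1#
    inner : ∀ n (u : Fin (suc (suc n)) → Carrier) (G : (Fin n → Fin (suc (suc n))) → Carrier) →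
      (∀ σ τ → (∀ l → σ l ≡ τ l) → G σ ≈ G τ) →
      sumFin (suc n) (λ j → sumFin n (λ k → sign (toℕ (suc j)) * (u (suc j) *
        (sign (toℕ (suc k)) * (u (punchIn (suc j) (suc k)) * G (punchIn (suc j) ∘ punchIn (suc k))))))) ≈ 0#
    inner zero    u G G-cong = sumFin-zero 1 (λ _ → refl)
    inner (suc n) u G G-cong =
      trans (sumFin-cong (suc (suc n)) (λ j → sumFin-cong (suc n) (λ k → signs-cancel j k)))
            (doubleExpansion≈0 n (u ∘ suc) (G ∘ Fin.lift 1) (λ σ τ σ≗τ → G-cong _ _ λ { zero → ≡.refl ; (suc l) → ≡.cong suc (σ≗τ l) }))
      where
      signs-cancel : ∀ j k →
        sign (toℕ (suc j)) * (u (suc j) * (sign (toℕ (suc k)) * (u (punchIn (suc j) (suc k)) * G (punchIn (suc j) ∘ punchIn (suc k)))))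
        ≈ sign (toℕ j) * (u (suc j) * (sign (toℕ k) * (u (suc (punchIn j k)) * G (Fin.lift 1 (punchIn j ∘ punchIn k)))))
      signs-cancel j k =
        trans (*-congˡ {sign (toℕ (suc j))} (*-congˡ (*-congˡ (*-congˡ (G-cong _ _ λ { zero → ≡.refl ; (suc l) → ≡.refl })))))
              (solve 5 (λ s x t y g → (:- s) :* (x :* ((:- t) :* (y :* g))) := s :* (x :* (t :* (y :* g)))) refl
                     (sign (toℕ j)) (u (suc j)) (sign (toℕ k)) (u (suc (punchIn j k))) (G (Fin.lift 1 (punchIn j ∘ punchIn k))))

  det-equalRows₀₁ : ∀ n (M : Matrix (suc (suc n))) → (∀ j → M zero j ≈ M (suc zero) j) → det (suc (suc n)) M ≈ 0#
  det-equalRows₀₁ n M row₀≈row₁ = trans (sumFin-cong (suc (suc n)) expand-minor)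
    (doubleExpansion≈0 n (M zero) G (λ σ τ σ≗τ → det-cong n (λ i l → reflexive (≡.cong (M (suc (suc i))) (σ≗τ l)))))
    where
    G : (Fin n → Fin (suc (suc n))) → Carrier
    G σ = det n (λ i l → M (suc (suc i)) (σ l))
    cofactor : Fin (suc (suc n)) → Fin (suc n) → Carrier
    cofactor j k = sign (toℕ k) * (M zero (punchIn j k) * G (punchIn j ∘ punchIn k))
    expand-minor : ∀ j → expansionTerm M j ≈ sumFin (suc n) (λ k → sign (toℕ j) * (M zero j * cofactor j k))
    expand-minor j = begin
      sign (toℕ j) * (M zero j * sumFin (suc n) (λ k → sign (toℕ k) * (M (suc zero) (punchIn j k) * G (punchIn j ∘ punchIn k))))
        ≈⟨ *-congˡ (*-congˡ (sumFin-cong (suc n) (λ k → *-congˡ {sign (toℕ k)} (*-congʳ {G (punchIn j ∘ punchIn k)} (sym (row₀≈row₁ (punchIn j k))))))) ⟩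
      sign (toℕ j) * (M zero j * sumFin (suc n) (cofactor j))
        ≈⟨ *-congˡ (*-distribˡ-sumFin (suc n) (M zero j) (cofactor j)) ⟩
      sign (toℕ j) * sumFin (suc n) (λ k → M zero j * cofactor j k)
        ≈⟨ *-distribˡ-sumFin (suc n) (sign (toℕ j)) (λ k → M zero j * cofactor j k) ⟩
      sumFin (suc n) (λ k → sign (toℕ j) * (M zero j * cofactor j k)) ∎

  Alternating : ℕ → Set _
  Alternating n = ∀ (M : Matrix n) r s → r ≢ s → (∀ j → M r j ≈ M s j) → det n M ≈ 0#

  setRow : ∀ {n} → Matrix n → Fin n → (Fin n → Carrier) → Matrix n
  setRow M r v = updateAt M r (const v)

  setRow-updates : ∀ {n} (M : Matrix n) r v j → setRow M r v r j ≈ v j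
  setRow-updates M r v j = reflexive (≡.cong-app (updateAt-updates r M) j)

  setRow-minimal : ∀ {n} (M : Matrix n) r v i → i ≢ r → ∀ j → setRow M r v i j ≈ M i j
  setRow-minimal M r v i i≢r j = reflexive (≡.cong-app (updateAt-minimal i r M i≢r) j)

  -- Bilinearity in rows 0 and t+1 expands det of the matrix with u + v in both rows
  -- into four terms, two of which vanish by the alternating property.
  det-swapRow₀ : ∀ n → Alternating (suc n) → ∀ (M M′ : Matrix (suc n)) (t : Fin n) →
    (∀ j → M′ zero j ≈ M (suc t) j) → (∀ j → M′ (suc t) j ≈ M zero j) →
    (∀ i → i ≢ t → ∀ j → M′ (suc i) j ≈ M (suc i) j) →
    det (suc n) M′ ≈ - det (suc n) M
  det-swapRow₀ n alternating M M′ t M′₀ M′ₜ M′ᵢ = inverseʳ-unique (det (suc n) M) (det (suc n) M′) sum≈0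
    where
    u = M zero
    v = M (suc t)
    Q : (Fin (suc n) → Carrier) → (Fin (suc n) → Carrier) → Matrix (suc n)
    Q x y = setRow (setRow M (suc t) y) zero x
    D : (Fin (suc n) → Carrier) → (Fin (suc n) → Carrier) → Carrier
    D x y = det (suc n) (Q x y)
    _⊞_ : (Fin (suc n) → Carrier) → (Fin (suc n) → Carrier) → Fin (suc n) → Carrier
    (x ⊞ y) j = x j + y j
    otherRows : ∀ x y y′ → RowsAgreeExcept (suc t) (Q x y) (Q x y′)
    otherRows x y y′ zero    _    j = refl
    otherRows x y y′ (suc i) i≢t j =
      trans (setRow-minimal M (suc t) y (suc i) i≢t j) (sym (setRow-minimal M (suc t) y′ (suc i) i≢t j))
    linear₀ : ∀ x₁ x₂ y → D (x₁ ⊞ x₂) y ≈ D x₁ y + D x₂ y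
    linear₀ x₁ x₂ y = trans
      (det-linear n (Q (x₁ ⊞ x₂) y) (Q x₁ y) (Q x₂ y) zero 1#
        (λ { zero 0≢0 → ⊥-elim (0≢0 ≡.refl) ; (suc i) _ j → refl })
        (λ { zero 0≢0 → ⊥-elim (0≢0 ≡.refl) ; (suc i) _ j → refl })
        (λ j → +-congʳ (sym (*-identityˡ _))))
      (+-congʳ (*-identityˡ _))
    linearₜ : ∀ x y₁ y₂ → D x (y₁ ⊞ y₂) ≈ D x y₁ + D x y₂
    linearₜ x y₁ y₂ = trans
      (det-linear n (Q x (y₁ ⊞ y₂)) (Q x y₁) (Q x y₂) (suc t) 1#
        (otherRows x y₁ (y₁ ⊞ y₂)) (otherRows x y₂ (y₁ ⊞ y₂))
        (λ j → trans (setRow-updates M (suc t) (y₁ ⊞ y₂) j)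
                     (+-cong (trans (sym (*-identityˡ _)) (*-congˡ (sym (setRow-updates M (suc t) y₁ j))))
                             (sym (setRow-updates M (suc t) y₂ j)))))
      (+-congʳ (*-identityˡ _))
    diagonal : ∀ w → D w w ≈ 0#
    diagonal w = alternating (Q w w) zero (suc t) (λ ()) (λ j → sym (setRow-updates M (suc t) w j))
    D-uv : D u v ≈ det (suc n) M
    D-uv = det-cong (suc n) {Q u v} {M} λ { zero j → refl ; (suc i) j → reflexive (≡.cong-app (updateAt-id-local (suc t) M ≡.refl (suc i)) j) }
    D-vu : D v u ≈ det (suc n) M′
    D-vu = det-cong (suc n) {Q v u} {M′} λ { zero j → sym (M′₀ j) ; (suc i) j → row i j }
      where
      row : ∀ i j → setRow M (suc t) u (suc i) j ≈ M′ (suc i) j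
      row i j with i Fin.≟ t
      ... | yes ≡.refl = trans (setRow-updates M (suc t) u j) (sym (M′ₜ j))
      ... | no i≢t     = trans (setRow-minimal M (suc t) u (suc i) (i≢t ∘ suc-injective) j) (sym (M′ᵢ i i≢t j))
    sum≈0 : det (suc n) M + det (suc n) M′ ≈ 0#
    sum≈0 = begin
      det (suc n) M + det (suc n) M′          ≈⟨ sym (+-cong D-uv D-vu) ⟩
      D u v + D v u                           ≈⟨ solve 2 (λ a b → a :+ b := (con (ℤ.+ 0) :+ a) :+ (b :+ con (ℤ.+ 0))) refl (D u v) (D v u) ⟩
      (0# + D u v) + (D v u + 0#)             ≈⟨ +-cong (+-congʳ (sym (diagonal u))) (+-congˡ (sym (diagonal v))) ⟩
      (D u u + D u v) + (D v u + D v v)       ≈⟨ sym (+-cong (linearₜ u u v) (linearₜ v u v)) ⟩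
      D u (u ⊞ v) + D v (u ⊞ v)               ≈⟨ sym (linear₀ u v (u ⊞ v)) ⟩
      D (u ⊞ v) (u ⊞ v)                       ≈⟨ diagonal (u ⊞ v) ⟩
      0#                                      ∎

  -- Swapping rows 1 and s+1 of the minors reduces to det-equalRows₀₁.
  det-equalRow₀ : ∀ n → Alternating n → (M : Matrix (suc n)) (s : Fin n) →
    (∀ j → M zero j ≈ M (suc s) j) → det (suc n) M ≈ 0#
  det-equalRow₀ (suc n)       alternating M zero    row₀≈row₁ = det-equalRows₀₁ n M row₀≈row₁
  det-equalRow₀ (suc (suc n)) alternating M (suc s) row₀≈rowₛ = begin
    det N M                ≈⟨ sym (-‿involutive _) ⟩
    - - det N M            ≈⟨ -‿cong (sym det-M′) ⟩
    - det N M′             ≈⟨ -‿cong (det-equalRows₀₁ (suc n) M′ row₀≈rowₛ) ⟩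
    - 0#                   ≈⟨ -0#≈0# ⟩
    0#                     ∎
    where
    N = suc (suc (suc n))
    M′ : Matrix N
    M′ = setRow (setRow M (suc zero) (M (suc (suc s)))) (suc (suc s)) (M (suc zero))
    det-M′ : det N M′ ≈ - det N M
    det-M′ = trans (sumFin-cong N λ j →
        trans (*-congˡ {sign (toℕ j)} (*-congˡ {M zero j}
          (det-swapRow₀ (suc n) alternating (minor M j) (minor M′ j) s (λ k → refl)
            (λ k → setRow-updates (setRow M (suc zero) (M (suc (suc s)))) (suc (suc s)) (M (suc zero)) (punchIn j k))
            (λ i i≢s k → setRow-minimal (setRow M (suc zero) (M (suc (suc s)))) (suc (suc s)) (M (suc zero)) (suc (suc i))
                           (i≢s ∘ suc-injective ∘ suc-injective) (punchIn j k)))))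
        (trans (*-congˡ (sym (-‿distribʳ-* (M zero j) _))) (sym (-‿distribʳ-* (sign (toℕ j)) _))))
      (-‿distrib-sumFin N (expansionTerm M))

  det-alternating : ∀ n → Alternating n
  det-alternating (suc n) M zero zero 0≢0 _ = ⊥-elim (0≢0 ≡.refl)
  det-alternating (suc n) M zero (suc s) _ row≈row = det-equalRow₀ n (det-alternating n) M s row≈row
  det-alternating (suc n) M (suc r) zero _ row≈row = det-equalRow₀ n (det-alternating n) M r (sym ∘ row≈row)
  det-alternating (suc (suc n)) M (suc r) (suc s) r≢s row≈row = sumFin-zero (suc (suc n)) λ j →
    trans (*-congˡ {sign (toℕ j)} (*-congˡ {M zero j}
            (det-alternating (suc n) (minor M j) r s (r≢s ∘ ≡.cong suc) (row≈row ∘ punchIn j))))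
          (trans (*-congˡ (zeroʳ _)) (zeroʳ _))

  det-zeroRow : ∀ n (M : Matrix (suc n)) r → (∀ j → M r j ≈ 0#) → det (suc n) M ≈ 0#
  det-zeroRow n M r Mr≈0 = begin
    det (suc n) M                        ≈⟨ det-linear n M M M r (- 1#) (λ _ _ _ → refl) (λ _ _ _ → refl) row ⟩
    - 1# * det (suc n) M + det (suc n) M ≈⟨ +-congʳ (trans (sym (-‿distribˡ-* 1# _)) (-‿cong (*-identityˡ _))) ⟩
    - det (suc n) M + det (suc n) M      ≈⟨ -‿inverseˡ _ ⟩
    0#                                   ∎
    where
    row : ∀ j → M r j ≈ - 1# * M r j + M r j
    row j = trans (Mr≈0 j) (sym (trans (+-cong (*-congˡ (Mr≈0 j)) (Mr≈0 j)) (trans (+-identityʳ _) (zeroʳ _))))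

  det-setRow-combination≈0 : ∀ n (M : Matrix (suc n)) r K (g : Fin K → Fin (suc n)) (a : Fin K → Carrier) →
    (∀ k → g k ≢ r) → det (suc n) (setRow M r (λ j → sumFin K (λ k → a k * M (g k) j))) ≈ 0#
  det-setRow-combination≈0 n M r zero    g a g≢r = det-zeroRow n (setRow M r (λ _ → 0#)) r (setRow-updates M r (λ _ → 0#))
  det-setRow-combination≈0 n M r (suc K) g a g≢r = begin
    det (suc n) (setRow M r combination)
      ≈⟨ det-linear n _ (setRow M r (M (g zero))) (setRow M r rest) r (a zero)
           (λ i i≢r j → trans (setRow-minimal M r _ i i≢r j) (sym (setRow-minimal M r _ i i≢r j)))
           (λ i i≢r j → trans (setRow-minimal M r _ i i≢r j) (sym (setRow-minimal M r _ i i≢r j)))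
           (λ j → trans (setRow-updates M r combination j)
                        (sym (+-cong (*-congˡ (setRow-updates M r (M (g zero)) j)) (setRow-updates M r rest j)))) ⟩
    a zero * det (suc n) (setRow M r (M (g zero))) + det (suc n) (setRow M r rest)
      ≈⟨ +-cong (*-congˡ repeatedRow) (det-setRow-combination≈0 n M r K (g ∘ suc) (a ∘ suc) (g≢r ∘ suc)) ⟩
    a zero * 0# + 0#
      ≈⟨ trans (+-identityʳ _) (zeroʳ _) ⟩
    0# ∎
    where
    combination rest : Fin (suc n) → Carrier
    combination j = sumFin (suc K) (λ k → a k * M (g k) j)
    rest j = sumFin K (λ k → a (suc k) * M (g (suc k)) j)
    repeatedRow : det (suc n) (setRow M r (M (g zero))) ≈ 0#
    repeatedRow = det-alternating (suc n) (setRow M r (M (g zero))) r (g zero) (g≢r zero ∘ ≡.sym)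
      (λ j → trans (setRow-updates M r (M (g zero)) j) (sym (setRow-minimal M r (M (g zero)) (g zero) (g≢r zero) j)))

  det-addCombinationOfOtherRows : ∀ n (M M′ : Matrix (suc n)) r (a : Fin n → Carrier) →
    RowsAgreeExcept r M′ M → (∀ j → M′ r j ≈ M r j + sumFin n (λ k → a k * M (punchIn r k) j)) →
    det (suc n) M′ ≈ det (suc n) M
  det-addCombinationOfOtherRows n M M′ r a M′≈M M′r = begin
    det (suc n) M′
      ≈⟨ det-linear n M′ M (setRow M r combination) r 1# (λ i i≢r j → sym (M′≈M i i≢r j))
           (λ i i≢r j → trans (setRow-minimal M r _ i i≢r j) (sym (M′≈M i i≢r j)))
           (λ j → trans (M′r j) (+-cong (sym (*-identityˡ _)) (sym (setRow-updates M r combination j)))) ⟩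
    1# * det (suc n) M + det (suc n) (setRow M r combination)
      ≈⟨ +-cong (*-identityˡ _) (det-setRow-combination≈0 n M r n (punchIn r) a (punchInᵢ≢i r)) ⟩
    det (suc n) M + 0#
      ≈⟨ +-identityʳ _ ⟩
    det (suc n) M ∎
    where
    combination : Fin (suc n) → Carrier
    combination j = sumFin n (λ k → a k * M (punchIn r k) j)

  det-zeroColumn₀ : ∀ n (M : Matrix (suc n)) → (∀ i → M i zero ≈ 0#) → det (suc n) M ≈ 0#
  det-zeroColumn₀ zero    M col≈0 =
    trans (+-identityʳ _) (trans (*-congˡ (trans (*-congʳ (col≈0 zero)) (zeroˡ _))) (zeroʳ _))
  det-zeroColumn₀ (suc n) M col≈0 = sumFin-zero (suc (suc n)) term≈0
    where
    term≈0 : ∀ j → expansionTerm M j ≈ 0#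
    term≈0 zero    = trans (*-congˡ (trans (*-congʳ (col≈0 zero)) (zeroˡ _))) (zeroʳ _)
    term≈0 (suc j) = trans (*-congˡ {sign (toℕ (suc j))}
                             (trans (*-congˡ (det-zeroColumn₀ n (minor M (suc j)) (col≈0 ∘ suc))) (zeroʳ _)))
                           (zeroʳ _)

  det-upperTriangular : ∀ n (M : Matrix (suc n)) (f : ℕ → Carrier) →
    (∀ i j → toℕ j < toℕ i → M i j ≈ 0#) → (∀ i → M i i ≈ f (toℕ i)) →
    det (suc n) M ≈ ∏ (suc n) f
  det-upperTriangular zero    M f lower≈0 diag =
    trans (+-identityʳ _) (trans (*-identityˡ _) (*-cong (diag zero) refl))
  det-upperTriangular (suc n) M f lower≈0 diag = begin
    expansionTerm M zero + sumFin (suc n) (expansionTerm M ∘ suc)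
      ≈⟨ +-cong (*-identityˡ _) (sumFin-zero (suc n) otherTerms≈0) ⟩
    M zero zero * det (suc n) (minor M zero) + 0#
      ≈⟨ +-identityʳ _ ⟩
    M zero zero * det (suc n) (minor M zero)
      ≈⟨ *-cong (diag zero) (det-upperTriangular n (minor M zero) (f ∘ suc)
                               (λ i j j<i → lower≈0 (suc i) (suc j) (s≤s j<i)) (diag ∘ suc)) ⟩
    ∏ (suc (suc n)) f ∎
    where
    otherTerms≈0 : ∀ j → expansionTerm M (suc j) ≈ 0#
    otherTerms≈0 j = trans (*-congˡ {sign (toℕ (suc j))} (trans (*-congˡ {M zero (suc j)}
                       (det-zeroColumn₀ n (minor M (suc j)) (λ i → lower≈0 (suc i) zero (s≤s z≤n)))) (zeroʳ _)))
                     (zeroʳ _)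

  -- The rows of R are replaced by those of U one at a time, from the top:
  -- row r of R is row r of U plus a combination of rows of U above it.
  det-unitLowerTriangular-* : ∀ n (T U R : Matrix (suc n)) →
    (∀ i m → toℕ i < toℕ m → T i m ≈ 0#) → (∀ i → T i i ≈ 1#) →
    (∀ i j → R i j ≈ sumFin (suc n) (λ m → T i m * U m j)) →
    det (suc n) R ≈ det (suc n) U
  det-unitLowerTriangular-* n T U R upper≈0 diagonal≈1 R≈TU = begin
    det (suc n) R                ≈⟨ sym (det-mixed≈det-R (suc n) ℕ.≤-refl) ⟩
    det (suc n) (mixed (suc n))  ≈⟨ det-cong (suc n) (λ i j → reflexive (≡.cong-app (mixed-< (suc n) i (toℕ<n i)) j)) ⟩
    det (suc n) U                ∎
    where
    mixed : ℕ → Matrix (suc n)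
    mixed t i = if does (toℕ i <? t) then U i else R i

    mixed-< : ∀ t i → toℕ i < t → mixed t i ≡ U i
    mixed-< t i i<t = ≡.cong (λ b → if b then U i else R i) (dec-true (toℕ i <? t) i<t)

    mixed-≮ : ∀ t i → ¬ toℕ i < t → mixed t i ≡ R i
    mixed-≮ t i i≮t = ≡.cong (λ b → if b then U i else R i) (dec-false (toℕ i <? t) i≮t)

    step : ∀ r → det (suc n) (mixed (suc (toℕ r))) ≈ det (suc n) (mixed (toℕ r))
    step r = sym (det-addCombinationOfOtherRows n (mixed (suc t)) (mixed t) r (T r ∘ punchIn r) otherRows row-r)
      where
      t = toℕ r
      otherRows : RowsAgreeExcept r (mixed t) (mixed (suc t))
      otherRows i i≢r j = by-cases (toℕ i <? t)
        where
        by-cases : Dec (toℕ i < t) → mixed t i j ≈ mixed (suc t) i j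
        by-cases (yes i<t) = reflexive (≡.cong-app (≡.trans (mixed-< t i i<t) (≡.sym (mixed-< (suc t) i (ℕ.m<n⇒m<1+n i<t)))) j)
        by-cases (no  i≮t) = reflexive (≡.cong-app (≡.trans (mixed-≮ t i i≮t) (≡.sym (mixed-≮ (suc t) i i≮1+t))) j)
          where
          i≮1+t : ¬ toℕ i < suc t
          i≮1+t (s≤s i≤t) = i≮t (ℕ.≤∧≢⇒< i≤t (i≢r ∘ toℕ-injective))
      U≈mixed : ∀ m j → T r m * U m j ≈ T r m * mixed (suc t) m j
      U≈mixed m j = by-cases (toℕ m <? suc t)
        where
        by-cases : Dec (toℕ m < suc t) → T r m * U m j ≈ T r m * mixed (suc t) m j
        by-cases (yes m≤t) = *-congˡ (reflexive (≡.cong-app (≡.sym (mixed-< (suc t) m m≤t)) j))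
        by-cases (no  m≰t) = trans (*-congʳ T≈0) (trans (zeroˡ _) (sym (trans (*-congʳ T≈0) (zeroˡ _))))
          where T≈0 = upper≈0 r m (ℕ.≰⇒> (m≰t ∘ s≤s))
      row-r : ∀ j → mixed t r j ≈ mixed (suc t) r j + sumFin n (λ k → T r (punchIn r k) * mixed (suc t) (punchIn r k) j)
      row-r j = begin
        mixed t r j
          ≡⟨ ≡.cong-app (mixed-≮ t r (ℕ.<-irrefl ≡.refl)) j ⟩
        R r j
          ≈⟨ trans (R≈TU r j) (sumFin-punchIn n (λ m → T r m * U m j) r) ⟩
        T r r * U r j + sumFin n (λ k → T r (punchIn r k) * U (punchIn r k) j)
          ≈⟨ +-cong (trans (*-congʳ (diagonal≈1 r)) (*-identityˡ _)) (sumFin-cong n (λ k → U≈mixed (punchIn r k) j)) ⟩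
        U r j + sumFin n (λ k → T r (punchIn r k) * mixed (suc t) (punchIn r k) j)
          ≈⟨ +-congʳ (reflexive (≡.cong-app (≡.sym (mixed-< (suc t) r (ℕ.n<1+n t))) j)) ⟩
        mixed (suc t) r j + sumFin n (λ k → T r (punchIn r k) * mixed (suc t) (punchIn r k) j) ∎

    det-mixed≈det-R : ∀ t → t ≤ suc n → det (suc n) (mixed t) ≈ det (suc n) R
    det-mixed≈det-R zero    _     = det-cong (suc n) (λ i j → reflexive (≡.cong-app (mixed-≮ 0 i (λ ())) j))
    det-mixed≈det-R (suc t) t<1+n = trans
      (≡.subst (λ t → det (suc n) (mixed (suc t)) ≈ det (suc n) (mixed t)) (toℕ-fromℕ< t<1+n) (step (fromℕ< t<1+n)))
      (det-mixed≈det-R t (ℕ.<⇒≤ t<1+n))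

module Moments {c ℓ : Level} (F : Field c ℓ) (A B C : Field.Carrier F)
  (A≉0 : ¬ (Field._≈_ F A (Field.0# F))) (L : ℕ → ℕ → Field.Carrier F)
  (isMomentFunctional : FieldDefs.Setting.IsMomentFunctional F A B C L) where
  open Field F hiding (zero)
  open FieldDefs F
  open Setting A B C
  open IsMomentFunctional isMomentFunctional
  open Polynomials F
  open Sums F using (∑; ∑-cong; ∑-+; ∑-last; ∑-zero)

  μ : ℕ → Carrier
  μ = moment L

  module Recurrences where
    open import Relation.Binary.Reasoning.Setoid setoid

    x−B≋ : xMinusB ≋ (X ⊕ negate (K B))
    x−B≋ = coeffwise λ
      { zero          → trans (trans (-‿cong (sym (*-identityˡ _))) (-‿distribˡ-* _ _)) (sym (+-identityˡ _))
      ; (suc zero)    → refl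
      ; (suc (suc k)) → refl }
      where open import Algebra.Properties.Ring ring using (-‿distribˡ-*)

    d≋ : dPoly ≋ (K C ⊕ (K A ⊗ X))
    d≋ = linear≋ C A

    shift≋ : ∀ n {p q} → p ≋ q → shift n p ≋ (X^ n ⊗ q)
    shift≋ n {p} p≋q = ≋-trans (shift≋X^⊗ n p) (⊗-congˡ (X^ n) p≋q)

    shift⁺≋ : ∀ n {p q} → p ≋ q → shift (suc n) p ≋ ((X ⊗ X^ n) ⊗ q)
    shift⁺≋ n {q = q} p≋q = ≋-trans (shift≋ (suc n) p≋q) (⊗-congʳ q (X^-suc n))

    scale≋ : ∀ a {p q} → p ≋ q → scale a p ≋ (K a ⊗ q)
    scale≋ a {p} p≋q = ≋-trans (scale≋K⊗ a p) (⊗-congˡ (K a) p≋q)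

    dPow≡ : ∀ {k l} → k ≡ l → dPow k ≋ dPow l
    dPow≡ ≡.refl = ≋-refl

    -- x^n (A x + C) Q₁ = x^n (x − B), because (A x + C) Q₁ = P₁
    combination₀ : ℕ → Comb
    combination₀ n = (A , suc n , 1) ∷ (C , n , 1) ∷ (- 1# , suc n , 0) ∷ (B , n , 0) ∷ []

    -- x^n (A x + C) Q_{m+2} = x^n ((x − B) Q_{m+1} − Q_m), the three-term recurrence divided by d^{m+1}
    combination : ℕ → ℕ → Comb
    combination n m = (A , suc n , suc (suc m)) ∷ (C , n , suc (suc m)) ∷ (- 1# , suc n , suc m) ∷ (B , n , suc m) ∷ (1# , n , m) ∷ []

    combination₀-vanishes : ∀ n → IsZeroComb (combination₀ n)
    combination₀-vanishes n = coeff-≈ (≋-trans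
        (⊕-cong (scale≋ A (shift⁺≋ n (⊗-congʳ I x−B≋))) (⊕-cong (scale≋ C (shift≋ n (⊗-congʳ I x−B≋)))
        (⊕-cong (scale-cong refl (shift⁺≋ n (⊗-congˡ I (⊗-congʳ I d≋)))) (⊕-cong (scale≋ B (shift≋ n (⊗-congˡ I (⊗-congʳ I d≋)))) ≋-refl))))
        (solve 5 (λ a b c x xn →
            a :* ((x :* xn) :* ((x :+ :- b) :* i)) :+ (c :* (xn :* ((x :+ :- b) :* i))
            :+ (:- ((x :* xn) :* (i :* ((c :+ a :* x) :* i))) :+ (b :* (xn :* (i :* ((c :+ a :* x) :* i))) :+ con (ℤ.+ 0))))
            := con (ℤ.+ 0))
          ≋-refl (K A) (K B) (K C) X (X^ n)))
      where
      open IntegerRingSolver polyRing using (solve; _:=_; _:+_; _:*_; :-_; con)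
      I = 1# ∷ []
      i = con (ℤ.+ 1)

    maxDen-combination : ∀ n m → maxDen (combination n m) ≡ suc (suc m)
    maxDen-combination n m =
      ≡.trans (≡.cong (λ k → 2+m ⊔ (2+m ⊔ (suc m ⊔ (suc m ⊔ k)))) (ℕ.⊔-identityʳ m))
      (≡.trans (≡.cong (λ k → 2+m ⊔ (2+m ⊔ (suc m ⊔ k))) (ℕ.m≥n⇒m⊔n≡m {suc m} {m} (ℕ.n≤1+n m)))
      (≡.trans (≡.cong (λ k → 2+m ⊔ (2+m ⊔ k)) (ℕ.m≥n⇒m⊔n≡m {suc m} {suc m} ℕ.≤-refl))
      (≡.trans (≡.cong (2+m ⊔_) (ℕ.m≥n⇒m⊔n≡m {2+m} {suc m} (ℕ.n≤1+n (suc m))))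
               (ℕ.m≥n⇒m⊔n≡m {2+m} {2+m} ℕ.≤-refl))))
      where 2+m = suc (suc m)

    combination-vanishes : ∀ n m → IsZeroComb (combination n m)
    combination-vanishes n m rewrite maxDen-combination n m = coeff-≈ (≋-trans
        (⊕-cong (scale≋ A (shift⁺≋ n (⊗-congˡ P₂ (dPow≡ (ℕ.n∸n≡0 m)))))
        (⊕-cong (scale≋ C (shift≋ n (⊗-congˡ P₂ (dPow≡ (ℕ.n∸n≡0 m)))))
        (⊕-cong (scale-cong refl (shift⁺≋ n (⊗-congˡ P₁ (dPow≡ (ℕ.m+n∸n≡m 1 m)))))
        (⊕-cong (scale≋ B (shift≋ n (⊗-congˡ P₁ (dPow≡ (ℕ.m+n∸n≡m 1 m)))))
        (⊕-cong (≋-trans (scale-identity _) (shift≋ n (⊗-congˡ P₀ (dPow≡ (ℕ.m+n∸n≡m 2 m))))) ≋-refl)))))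
        (≋-trans
          (⊕-cong (⊗-congˡ (K A) (⊗-congˡ (X ⊗ X^ n) (⊗-congʳ I P₂≋)))
          (⊕-cong (⊗-congˡ (K C) (⊗-congˡ (X^ n) (⊗-congʳ I P₂≋)))
          (⊕-cong (scale-cong refl (⊗-congˡ (X ⊗ X^ n) (⊗-congˡ P₁ (⊗-congʳ I d≋))))
          (⊕-cong (⊗-congˡ (K B) (⊗-congˡ (X^ n) (⊗-congˡ P₁ (⊗-congʳ I d≋))))
          (⊕-cong (⊗-congˡ (X^ n) (⊗-congˡ P₀ (⊗-cong d≋ (⊗-congʳ I d≋)))) ≋-refl)))))
        (solve 7 (λ a b c x xn p₁ p₀ →
            let d  = c :+ a :* x
                p₂ = (x :+ :- b) :* p₁ :+ :- (d :* p₀)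
            in a :* ((x :* xn) :* (p₂ :* i)) :+ (c :* (xn :* (p₂ :* i))
               :+ (:- ((x :* xn) :* (p₁ :* (d :* i))) :+ (b :* (xn :* (p₁ :* (d :* i)))
               :+ (xn :* (p₀ :* (d :* (d :* i))) :+ con (ℤ.+ 0)))))
            := con (ℤ.+ 0))
          ≋-refl (K A) (K B) (K C) X (X^ n) P₁ P₀)))
      where
      open IntegerRingSolver polyRing using (solve; _:=_; _:+_; _:*_; :-_; con)
      I = 1# ∷ []
      i = con (ℤ.+ 1)
      P₀ = Pol m
      P₁ = Pol (suc m)
      P₂ = Pol (suc (suc m))
      P₂≋ : P₂ ≋ (((X ⊕ negate (K B)) ⊗ P₁) ⊕ negate ((K C ⊕ (K A ⊗ X)) ⊗ P₀))
      P₂≋ = ⊕-cong (⊗-congʳ P₁ x−B≋) (scale-cong refl (⊗-congʳ P₀ d≋))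

    isolate : ∀ s t z u → s + (t + (- 1# * z + u)) ≈ 0# → z ≈ s + t + u
    isolate s t z u sum≈0 = begin
      z                                  ≈⟨ sym (+-identityʳ z) ⟩
      z + 0#                             ≈⟨ +-congˡ (sym sum≈0) ⟩
      z + (s + (t + (- 1# * z + u)))     ≈⟨ solve 4 (λ s t z u → z :+ (s :+ (t :+ (:- con (ℤ.+ 1) :* z :+ u))) := s :+ t :+ u) refl s t z u ⟩
      s + t + u                          ∎
      where
      open IntegerRingSolver commutativeRing using (solve; _:=_; _:+_; _:*_; :-_; con)

    -- L⁻ n m = 𝓛(xⁿ Q_{m−1}), where Q_{−1} = 0
    L⁻ : ℕ → ℕ → Carrier
    L⁻ n zero    = 0#
    L⁻ n (suc m) = L n m

    L-recurrence : ∀ n m → L (suc n) m ≈ A * L (suc n) (suc m) + C * L n (suc m) + (B * L n m + L⁻ n m)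
    L-recurrence n zero    = isolate _ _ _ _ (linear (combination₀ n) (combination₀-vanishes n))
    L-recurrence n (suc m) = trans (isolate _ _ _ _ (linear (combination n m) (combination-vanishes n m)))
                                   (+-congˡ (+-congˡ (trans (+-identityʳ _) (*-identityˡ _))))

    L-diagonal : ∀ m → L m m ≈ 1#
    L-diagonal zero    = normalised
    L-diagonal (suc n) = begin
      L (suc n) (suc n)
        ≈⟨ L-recurrence n (suc n) ⟩
      A * L (suc n) (suc (suc n)) + C * L n (suc (suc n)) + (B * L n (suc n) + L n n)
        ≈⟨ +-cong (+-cong (vanishes ℕ.≤-refl) (vanishes (ℕ.n≤1+n (suc n)))) (+-cong (vanishes ℕ.≤-refl) (L-diagonal n)) ⟩
      0# + 0# + (0# + 1#)
        ≈⟨ trans (+-congʳ (+-identityʳ 0#)) (trans (+-identityˡ _) (+-identityˡ 1#)) ⟩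
      1# ∎
      where
      vanishes : ∀ {a k m} → k < m → a * L k m ≈ 0#
      vanishes k<m = trans (*-congˡ (orthogonal _ _ k<m)) (zeroʳ _)

    Λ : Carrier
    Λ = A * A + A * B + C

    b : ℕ → Carrier
    b zero    = A + B
    b (suc m) = A + A + B

    -- motzkin k m is the coefficient of R_m in xᵏ, where x R_m = R_{m+1} + b_m R_m + Λ R_{m−1};
    -- equivalently, Motzkin paths from height 0 to m weighted b_h per level step at height h
    -- and Λ per down step.
    motzkin : ℕ → ℕ → Carrier
    motzkin zero    zero    = 1#
    motzkin zero    (suc m) = 0#
    motzkin (suc k) zero    = b zero * motzkin k zero + Λ * motzkin k 1
    motzkin (suc k) (suc m) = motzkin k m + b (suc m) * motzkin k (suc m) + Λ * motzkin k (suc (suc m))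

    motzkin-upper : ∀ {k m} → k < m → motzkin k m ≈ 0#
    motzkin-upper {zero}  {suc m} _         = refl
    motzkin-upper {suc k} {suc m} (s≤s k<m) = begin
      motzkin k m + b (suc m) * motzkin k (suc m) + Λ * motzkin k (suc (suc m))
        ≈⟨ +-cong (+-cong (motzkin-upper k<m) (*-congˡ (motzkin-upper (ℕ.m<n⇒m<1+n k<m))))
                  (*-congˡ (motzkin-upper (ℕ.m<n⇒m<1+n (ℕ.m<n⇒m<1+n k<m)))) ⟩
      0# + b (suc m) * 0# + Λ * 0#
        ≈⟨ trans (+-cong (trans (+-identityˡ _) (zeroʳ _)) (zeroʳ _)) (+-identityʳ 0#) ⟩
      0# ∎

    motzkin-diagonal : ∀ k → motzkin k k ≈ 1#
    motzkin-diagonal zero    = refl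
    motzkin-diagonal (suc k) = begin
      motzkin k k + b (suc k) * motzkin k (suc k) + Λ * motzkin k (suc (suc k))
        ≈⟨ +-cong (+-cong (motzkin-diagonal k) (*-congˡ (motzkin-upper (ℕ.n<1+n k))))
                  (*-congˡ (motzkin-upper (ℕ.m<n⇒m<1+n (ℕ.n<1+n k)))) ⟩
      1# + b (suc k) * 0# + Λ * 0#
        ≈⟨ trans (+-cong (trans (+-congˡ (zeroʳ _)) (+-identityʳ 1#)) (zeroʳ _)) (+-identityʳ 1#) ⟩
      1# ∎

    N : ℕ → Poly
    N k = fromCoeffs (L k) (suc k)

    H : ℕ → Poly
    H k = fromCoeffs (motzkin k) (suc k)

    coeff-N : ∀ k j → coeff (N k) j ≈ L k j
    coeff-N k j = coeff-fromCoeffs (L k) (suc k) j (orthogonal k j)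

    coeff-H : ∀ k j → coeff (H k) j ≈ motzkin k j
    coeff-H k j = coeff-fromCoeffs (motzkin k) (suc k) j motzkin-upper

    coeff-0∷N : ∀ n j → coeff (0# ∷ N n) j ≈ L⁻ n j
    coeff-0∷N n zero    = refl
    coeff-0∷N n (suc j) = coeff-N n j

    coeff-⊕₃ : ∀ p q r j → coeff (p ⊕ (q ⊕ r)) j ≈ coeff p j + (coeff q j + coeff r j)
    coeff-⊕₃ p q r j = trans (coeff-⊕ p (q ⊕ r) j) (+-congˡ (coeff-⊕ q r j))

    coeff-⊕₄ : ∀ p q r s j → coeff (p ⊕ (q ⊕ (r ⊕ s))) j ≈ coeff p j + (coeff q j + (coeff r j + coeff s j))
    coeff-⊕₄ p q r s j = trans (coeff-⊕ p (q ⊕ (r ⊕ s)) j) (+-congˡ (coeff-⊕₃ q r s j))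

    N-recurrence : ∀ n →
      ((0# ∷ N (suc n)) ⊕ (scale (- A) (N (suc n)) ⊕ K (A * μ (suc n))))
      ≋ ((0# ∷ 0# ∷ N n) ⊕ (scale B (0# ∷ N n) ⊕ (scale C (N n) ⊕ K (- (C * μ n)))))
    N-recurrence n = coeffwise λ j →
      trans (coeff-⊕₃ (0# ∷ N (suc n)) (scale (- A) (N (suc n))) (K (A * μ (suc n))) j)
            (trans (at j) (sym (coeff-⊕₄ (0# ∷ 0# ∷ N n) (scale B (0# ∷ N n)) (scale C (N n)) (K (- (C * μ n))) j)))
      where
      open IntegerRingSolver commutativeRing using (solve; _:=_; _:+_; _:*_; :-_; con)
      at : ∀ j → coeff (0# ∷ N (suc n)) j + (coeff (scale (- A) (N (suc n))) j + coeff (K (A * μ (suc n))) j)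
               ≈ coeff (0# ∷ 0# ∷ N n) j + (coeff (scale B (0# ∷ N n)) j + (coeff (scale C (N n)) j + coeff (K (- (C * μ n))) j))
      at zero = begin
        0# + (coeff (scale (- A) (N (suc n))) 0 + A * μ (suc n))
          ≈⟨ +-congˡ (+-congʳ (trans (coeff-scale (- A) (N (suc n)) 0) (*-congˡ (coeff-N (suc n) 0)))) ⟩
        0# + (- A * μ (suc n) + A * μ (suc n))
          ≈⟨ solve 5 (λ a x b c y → con (ℤ.+ 0) :+ (:- a :* x :+ a :* x) := con (ℤ.+ 0) :+ (b :* con (ℤ.+ 0) :+ (c :* y :+ :- (c :* y))))
                   refl A (μ (suc n)) B C (μ n) ⟩
        0# + (B * 0# + (C * μ n + - (C * μ n)))
          ≈⟨ +-congˡ (+-cong (sym (coeff-scale B (0# ∷ N n) 0)) (+-congʳ (sym (trans (coeff-scale C (N n) 0) (*-congˡ (coeff-N n 0)))))) ⟩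
        0# + (coeff (scale B (0# ∷ N n)) 0 + (coeff (scale C (N n)) 0 + - (C * μ n))) ∎
      at (suc j) = begin
        coeff (N (suc n)) j + (coeff (scale (- A) (N (suc n))) (suc j) + 0#)
          ≈⟨ +-cong (coeff-N (suc n) j) (+-congʳ (trans (coeff-scale (- A) (N (suc n)) (suc j)) (*-congˡ (coeff-N (suc n) (suc j))))) ⟩
        L (suc n) j + (- A * L (suc n) (suc j) + 0#)
          ≈⟨ +-congʳ (L-recurrence n j) ⟩
        A * L (suc n) (suc j) + C * L n (suc j) + (B * L n j + L⁻ n j) + (- A * L (suc n) (suc j) + 0#)
          ≈⟨ solve 7 (λ a c b x y z l → (a :* x :+ c :* y :+ (b :* z :+ l)) :+ (:- a :* x :+ con (ℤ.+ 0)) := l :+ (b :* z :+ (c :* y :+ con (ℤ.+ 0))))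
                   refl A C B (L (suc n) (suc j)) (L n (suc j)) (L n j) (L⁻ n j) ⟩
        L⁻ n j + (B * L n j + (C * L n (suc j) + 0#))
          ≈⟨ sym (+-cong (coeff-0∷N n j) (+-cong (trans (coeff-scale B (0# ∷ N n) (suc j)) (*-congˡ (coeff-N n j)))
                                                (+-congʳ (trans (coeff-scale C (N n) (suc j)) (*-congˡ (coeff-N n (suc j))))))) ⟩
        coeff (0# ∷ N n) j + (coeff (scale B (0# ∷ N n)) (suc j) + (coeff (scale C (N n)) (suc j) + 0#)) ∎

    H-recurrence : ∀ n →
      (0# ∷ H (suc n)) ≋ ((0# ∷ 0# ∷ H n) ⊕ (scale (b 1) (0# ∷ H n) ⊕ (scale Λ (H n) ⊕ negate (scale (motzkin n 0) (Λ ∷ A ∷ [])))))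
    H-recurrence n = coeffwise λ j →
      trans (at j) (sym (coeff-⊕₄ (0# ∷ 0# ∷ H n) (scale (b 1) (0# ∷ H n)) (scale Λ (H n)) S j))
      where
      open IntegerRingSolver commutativeRing using (solve; _:=_; _:+_; _:*_; :-_; con)
      S = negate (scale (motzkin n 0) (Λ ∷ A ∷ []))
      h = motzkin n
      at : ∀ j → coeff (0# ∷ H (suc n)) j ≈ coeff (0# ∷ 0# ∷ H n) j + (coeff (scale (b 1) (0# ∷ H n)) j + (coeff (scale Λ (H n)) j + coeff S j))
      at zero = begin
        0#
          ≈⟨ solve 3 (λ β l x → con (ℤ.+ 0) := con (ℤ.+ 0) :+ (β :* con (ℤ.+ 0) :+ (l :* x :+ :- con (ℤ.+ 1) :* (x :* l)))) refl (b 1) Λ (h 0) ⟩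
        0# + (b 1 * 0# + (Λ * h 0 + - 1# * (h 0 * Λ)))
          ≈⟨ +-congˡ (+-cong (sym (coeff-scale (b 1) (0# ∷ H n) 0)) (+-congʳ (sym (trans (coeff-scale Λ (H n) 0) (*-congˡ (coeff-H n 0)))))) ⟩
        0# + (coeff (scale (b 1) (0# ∷ H n)) 0 + (coeff (scale Λ (H n)) 0 + coeff S 0)) ∎
      at (suc zero) = begin
        coeff (H (suc n)) 0
          ≈⟨ coeff-H (suc n) 0 ⟩
        (A + B) * h 0 + Λ * h 1
          ≈⟨ solve 5 (λ a β l x y → (a :+ β) :* x :+ l :* y := con (ℤ.+ 0) :+ ((a :+ a :+ β) :* x :+ (l :* y :+ :- con (ℤ.+ 1) :* (x :* a))))
                   refl A B Λ (h 0) (h 1) ⟩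
        0# + (b 1 * h 0 + (Λ * h 1 + - 1# * (h 0 * A)))
          ≈⟨ +-congˡ (+-cong (sym (trans (coeff-scale (b 1) (0# ∷ H n) 1) (*-congˡ (coeff-H n 0))))
                             (+-congʳ (sym (trans (coeff-scale Λ (H n) 1) (*-congˡ (coeff-H n 1)))))) ⟩
        0# + (coeff (scale (b 1) (0# ∷ H n)) 1 + (coeff (scale Λ (H n)) 1 + coeff S 1)) ∎
      at (suc (suc j)) = begin
        coeff (H (suc n)) (suc j)
          ≈⟨ coeff-H (suc n) (suc j) ⟩
        h j + b 1 * h (suc j) + Λ * h (suc (suc j))
          ≈⟨ solve 5 (λ β l x y z → x :+ β :* y :+ l :* z := x :+ (β :* y :+ (l :* z :+ con (ℤ.+ 0)))) refl (b 1) Λ (h j) (h (suc j)) (h (suc (suc j))) ⟩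
        h j + (b 1 * h (suc j) + (Λ * h (suc (suc j)) + 0#))
          ≈⟨ sym (+-cong (coeff-H n j) (+-cong (trans (coeff-scale (b 1) (0# ∷ H n) (suc (suc j))) (*-congˡ (coeff-H n (suc j))))
                    (+-congʳ (trans (coeff-scale Λ (H n) (suc (suc j))) (*-congˡ (coeff-H n (suc (suc j)))))))) ⟩
        coeff (H n) j + (coeff (scale (b 1) (0# ∷ H n)) (suc (suc j)) + (coeff (scale Λ (H n)) (suc (suc j)) + coeff S (suc (suc j)))) ∎

    *-cancelˡ : ∀ {a x y} → ¬ (a ≈ 0#) → a * x ≈ a * y → x ≈ y
    *-cancelˡ {a} {x} {y} a≉0 ax≈ay = begin
      x                  ≈⟨ sym (*-identityˡ x) ⟩
      1# * x             ≈⟨ *-congʳ (sym a⁻¹a≈1) ⟩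
      (a⁻¹ * a) * x      ≈⟨ *-assoc _ _ _ ⟩
      a⁻¹ * (a * x)      ≈⟨ *-congˡ ax≈ay ⟩
      a⁻¹ * (a * y)      ≈⟨ sym (*-assoc _ _ _) ⟩
      (a⁻¹ * a) * y      ≈⟨ *-congʳ a⁻¹a≈1 ⟩
      1# * y             ≈⟨ *-identityˡ y ⟩
      y                  ∎
      where
      a⁻¹ = inv a a≉0
      a⁻¹a≈1 : a⁻¹ * a ≈ 1#
      a⁻¹a≈1 = trans (*-comm _ _) (inv-inverse a a≉0)

  module Translation where
    open Recurrences
    open ≋-Reasoning

    τ : Poly → Poly
    τ = translate A

    α β γ : Poly
    α = K A
    β = K B
    γ = K C

    Λ≋ : K Λ ≋ (((α ⊗ α) ⊕ (α ⊗ β)) ⊕ γ)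
    Λ≋ = ⊕-cong (⊕-cong (K-* A A) (K-* A B)) (≋-refl {γ})

    translated-N-recurrence : ∀ n →
      ((X ⊗ τ (N (suc n))) ⊕ (α ⊗ K (μ (suc n))))
      ≋ (((((X ⊕ α) ⊗ (X ⊕ α)) ⊕ (β ⊗ (X ⊕ α))) ⊕ γ) ⊗ τ (N n)) ⊕ negate (γ ⊗ K (μ n))
    translated-N-recurrence n = begin
      (X ⊗ t′) ⊕ (α ⊗ m′)
        ≈⟨ solve 4 (λ x a t′ m′ → x :* t′ :+ a :* m′ := (x :+ a) :* t′ :+ ((:- a) :* t′ :+ a :* m′)) ≋-refl X α t′ m′ ⟩
      ((X ⊕ α) ⊗ t′) ⊕ ((negate α ⊗ t′) ⊕ (α ⊗ m′))
        ≈⟨ ≋-sym τ-lhs ⟩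
      τ ((0# ∷ N (suc n)) ⊕ (scale (- A) (N (suc n)) ⊕ K (A * μ (suc n))))
        ≈⟨ translate-cong A (N-recurrence n) ⟩
      τ ((0# ∷ 0# ∷ N n) ⊕ (scale B (0# ∷ N n) ⊕ (scale C (N n) ⊕ K (- (C * μ n)))))
        ≈⟨ τ-rhs ⟩
      ((X ⊕ α) ⊗ ((X ⊕ α) ⊗ t)) ⊕ ((β ⊗ ((X ⊕ α) ⊗ t)) ⊕ ((γ ⊗ t) ⊕ negate (γ ⊗ m)))
        ≈⟨ solve 6 (λ x a b c t m → (x :+ a) :* ((x :+ a) :* t) :+ (b :* ((x :+ a) :* t) :+ (c :* t :+ :- (c :* m)))
                                    := (((x :+ a) :* (x :+ a) :+ b :* (x :+ a)) :+ c) :* t :+ :- (c :* m))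
                 ≋-refl X α β γ t m ⟩
      (((((X ⊕ α) ⊗ (X ⊕ α)) ⊕ (β ⊗ (X ⊕ α))) ⊕ γ) ⊗ t) ⊕ negate (γ ⊗ m) ∎
      where
      open IntegerRingSolver polyRing using (solve; _:=_; _:+_; _:*_; :-_)
      t  = τ (N n)
      t′ = τ (N (suc n))
      m  = K (μ n)
      m′ = K (μ (suc n))
      τ-lhs : τ ((0# ∷ N (suc n)) ⊕ (scale (- A) (N (suc n)) ⊕ K (A * μ (suc n))))
              ≋ (((X ⊕ α) ⊗ t′) ⊕ ((negate α ⊗ t′) ⊕ (α ⊗ m′)))
      τ-lhs = ≋-trans (translate-⊕ A (0# ∷ N (suc n)) (scale (- A) (N (suc n)) ⊕ K (A * μ (suc n))))
                (⊕-cong (translate-0∷ A (N (suc n)))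
                  (≋-trans (translate-⊕ A (scale (- A) (N (suc n))) (K (A * μ (suc n))))
                    (⊕-cong (≋-trans (translate-scale A (- A) (N (suc n))) (⊗-congʳ t′ (K-neg A)))
                            (≋-trans (translate-K A (A * μ (suc n))) (K-* A (μ (suc n)))))))
      τ-rhs : τ ((0# ∷ 0# ∷ N n) ⊕ (scale B (0# ∷ N n) ⊕ (scale C (N n) ⊕ K (- (C * μ n)))))
              ≋ (((X ⊕ α) ⊗ ((X ⊕ α) ⊗ t)) ⊕ ((β ⊗ ((X ⊕ α) ⊗ t)) ⊕ ((γ ⊗ t) ⊕ negate (γ ⊗ m))))
      τ-rhs = ≋-trans (translate-⊕ A (0# ∷ 0# ∷ N n) (scale B (0# ∷ N n) ⊕ (scale C (N n) ⊕ K (- (C * μ n)))))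
                (⊕-cong (≋-trans (translate-0∷ A (0# ∷ N n)) (⊗-congˡ (X ⊕ α) (translate-0∷ A (N n))))
                  (≋-trans (translate-⊕ A (scale B (0# ∷ N n)) (scale C (N n) ⊕ K (- (C * μ n))))
                    (⊕-cong (≋-trans (translate-scale A B (0# ∷ N n)) (⊗-congˡ β (translate-0∷ A (N n))))
                      (≋-trans (translate-⊕ A (scale C (N n)) (K (- (C * μ n))))
                        (⊕-cong (translate-scale A C (N n))
                                (≋-trans (translate-K A (- (C * μ n))) (≋-trans (K-neg (C * μ n)) (scale-cong refl (K-* C (μ n))))))))))

    Λₚ : Poly
    Λₚ = ((α ⊗ α) ⊕ (α ⊗ β)) ⊕ γ

    X⊗H-recurrence : ∀ n →
      (X ⊗ H (suc n)) ≋ ((((X ⊗ X) ⊕ (((α ⊕ α) ⊕ β) ⊗ X)) ⊕ Λₚ) ⊗ H n) ⊕ negate (K (motzkin n 0) ⊗ (Λₚ ⊕ (α ⊗ X)))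
    X⊗H-recurrence n = begin
      X ⊗ H (suc n)
        ≈⟨ ≋-trans (X⊗ (H (suc n))) (H-recurrence n) ⟩
      (0# ∷ 0# ∷ H n) ⊕ (scale (b 1) (0# ∷ H n) ⊕ (scale Λ (H n) ⊕ negate (scale (motzkin n 0) (Λ ∷ A ∷ []))))
        ≈⟨ ⊕-cong (≋-trans (∷-cong refl (≋-sym (X⊗ (H n)))) (≋-sym (X⊗ (X ⊗ H n))))
           (⊕-cong (scale≋ (b 1) (≋-sym (X⊗ (H n))))
           (⊕-cong (≋-trans (scale≋K⊗ Λ (H n)) (⊗-congʳ (H n) Λ≋))
                   (scale-cong refl (scale≋ (motzkin n 0) (≋-trans (linear≋ Λ A) (⊕-cong Λ≋ (≋-refl {α ⊗ X}))))))) ⟩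
      (X ⊗ (X ⊗ H n)) ⊕ ((((α ⊕ α) ⊕ β) ⊗ (X ⊗ H n)) ⊕ ((Λₚ ⊗ H n) ⊕ negate (K (motzkin n 0) ⊗ (Λₚ ⊕ (α ⊗ X)))))
        ≈⟨ solve 5 (λ x b′ l h r → x :* (x :* h) :+ (b′ :* (x :* h) :+ (l :* h :+ :- r)) := ((x :* x :+ b′ :* x) :+ l) :* h :+ :- r)
                 ≋-refl X ((α ⊕ α) ⊕ β) Λₚ (H n) (K (motzkin n 0) ⊗ (Λₚ ⊕ (α ⊗ X))) ⟩
      ((((X ⊗ X) ⊕ (((α ⊕ α) ⊕ β) ⊗ X)) ⊕ Λₚ) ⊗ H n) ⊕ negate (K (motzkin n 0) ⊗ (Λₚ ⊕ (α ⊗ X))) ∎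
      where open IntegerRingSolver polyRing using (solve; _:=_; _:+_; _:*_; :-_)

    KeyIdentity : ℕ → Set ℓ
    KeyIdentity k = ((X ⊕ α) ⊗ H k) ≋ ((α ⊗ K (μ k)) ⊕ (X ⊗ τ (N k)))

    motzkin≈μ-from : ∀ k → KeyIdentity k → motzkin k 0 ≈ μ k
    motzkin≈μ-from k e = *-cancelˡ A≉0 (S.begin
      A * motzkin k 0                      S.≈⟨ sym (trans (+-identityʳ _) (*-congʳ (+-identityˡ A))) ⟩
      (0# + A) * motzkin k 0 + 0#          S.≈⟨ coeff-≈ e 0 ⟩
      coeff ((α ⊗ K (μ k)) ⊕ (X ⊗ τ (N k))) 0
        S.≈⟨ trans (coeff-⊕ (α ⊗ K (μ k)) (X ⊗ τ (N k)) 0) (+-congˡ (coeff-≈ (X⊗ (τ (N k))) 0)) ⟩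
      (A * μ k + 0#) + 0#                  S.≈⟨ trans (+-identityʳ _) (+-identityʳ _) ⟩
      A * μ k                              S.∎)
      where module S = Relation.Binary.Reasoning.Setoid setoid

    key-identity : ∀ k → KeyIdentity k
    key-identity zero = begin
      (X ⊕ α) ⊗ I
        ≈⟨ solve 2 (λ x a → (x :+ a) :* con (ℤ.+ 1) := a :* con (ℤ.+ 1) :+ x :* con (ℤ.+ 1)) ≋-refl X α ⟩
      (α ⊗ I) ⊕ (X ⊗ I)
        ≈⟨ ⊕-cong (⊗-congˡ α (K-cong (sym normalised))) (⊗-congˡ X (≋-sym (≋-trans (translate-K A (L 0 0)) (K-cong normalised)))) ⟩
      (α ⊗ K (μ 0)) ⊕ (X ⊗ τ (N 0)) ∎
      where
      open IntegerRingSolver polyRing using (solve; _:=_; _:+_; _:*_; con)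
      I = 1# ∷ []
    -- After multiplying by x the two recurrences match, since (x + A)² + B (x + A) + C = x² + (2A + B) x + Λ.
    key-identity (suc n) = X⊗-cancel (begin
      X ⊗ ((X ⊕ α) ⊗ H (suc n))
        ≈⟨ solve 3 (λ x a h′ → x :* ((x :+ a) :* h′) := (x :+ a) :* (x :* h′)) ≋-refl X α (H (suc n)) ⟩
      (X ⊕ α) ⊗ (X ⊗ H (suc n))
        ≈⟨ ⊗-congˡ (X ⊕ α) (X⊗H-recurrence n) ⟩
      (X ⊕ α) ⊗ ((P ⊗ H n) ⊕ negate (K (motzkin n 0) ⊗ (Λₚ ⊕ (α ⊗ X))))
        ≈⟨ solve 6 (λ x a p h h₀ r → (x :+ a) :* (p :* h :+ :- (h₀ :* r)) := p :* ((x :+ a) :* h) :+ :- ((x :+ a) :* (h₀ :* r)))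
                 ≋-refl X α P (H n) (K (motzkin n 0)) (Λₚ ⊕ (α ⊗ X)) ⟩
      (P ⊗ ((X ⊕ α) ⊗ H n)) ⊕ negate ((X ⊕ α) ⊗ (K (motzkin n 0) ⊗ (Λₚ ⊕ (α ⊗ X))))
        ≈⟨ ⊕-cong (⊗-congˡ P IH) (scale-cong refl (⊗-congˡ (X ⊕ α) (⊗-congʳ (Λₚ ⊕ (α ⊗ X)) (K-cong (motzkin≈μ-from n IH))))) ⟩
      (P ⊗ ((α ⊗ m) ⊕ (X ⊗ t))) ⊕ negate ((X ⊕ α) ⊗ (m ⊗ (Λₚ ⊕ (α ⊗ X))))
        ≈⟨ solve 6 (λ x a b c m t →
               let l = (a :* a :+ a :* b) :+ c
               in ((x :* x :+ ((a :+ a) :+ b) :* x) :+ l) :* (a :* m :+ x :* t) :+ :- ((x :+ a) :* (m :* (l :+ a :* x)))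
                  := x :* ((((x :+ a) :* (x :+ a) :+ b :* (x :+ a)) :+ c) :* t :+ :- (c :* m)))
                 ≋-refl X α β γ m t ⟩
      X ⊗ ((((((X ⊕ α) ⊗ (X ⊕ α)) ⊕ (β ⊗ (X ⊕ α))) ⊕ γ) ⊗ t) ⊕ negate (γ ⊗ m))
        ≈⟨ ⊗-congˡ X (≋-sym (translated-N-recurrence n)) ⟩
      X ⊗ ((X ⊗ τ (N (suc n))) ⊕ (α ⊗ K (μ (suc n))))
        ≈⟨ ⊗-congˡ X (⊕-comm (X ⊗ τ (N (suc n))) (α ⊗ K (μ (suc n)))) ⟩
      X ⊗ ((α ⊗ K (μ (suc n))) ⊕ (X ⊗ τ (N (suc n)))) ∎)
      where
      open IntegerRingSolver polyRing using (solve; _:=_; _:+_; _:*_; :-_)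
      IH = key-identity n
      P = ((X ⊗ X) ⊕ (((α ⊕ α) ⊕ β) ⊗ X)) ⊕ Λₚ
      m = K (μ n)
      t = τ (N n)
      X⊗-cancel : ∀ {p q} → (X ⊗ p) ≋ (X ⊗ q) → p ≋ q
      X⊗-cancel {p} {q} e = ∷-injectiveʳ (≋-trans (≋-sym (X⊗ p)) (≋-trans e (X⊗ q)))

    motzkin≈μ : ∀ k → motzkin k 0 ≈ μ k
    motzkin≈μ k = motzkin≈μ-from k (key-identity k)

  module Factorisation where
    open Recurrences
    open Translation using (motzkin≈μ)
    open import Relation.Binary.Reasoning.Setoid setoid
    open IntegerRingSolver commutativeRing using (solve; _:=_; _:+_; _:*_)

    -- motzkin⁻ i m = motzkin i (m − 1), where motzkin i (−1) = 0
    motzkin⁻ : ℕ → ℕ → Carrier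
    motzkin⁻ i zero    = 0#
    motzkin⁻ i (suc m) = motzkin i m

    motzkin-suc : ∀ i m → motzkin (suc i) m ≈ motzkin⁻ i m + b m * motzkin i m + Λ * motzkin i (suc m)
    motzkin-suc i zero    = sym (+-congʳ (+-identityˡ _))
    motzkin-suc i (suc m) = refl

    weight : ℕ → ℕ → Carrier
    weight j m = pow Λ m * motzkin j m

    ∑-lowering : ∀ n i j → i < n →
      ∑ (suc n) (λ m → motzkin⁻ i m * weight j m) ≈ ∑ (suc n) (λ m → motzkin i m * (pow Λ m * (Λ * motzkin j (suc m))))
    ∑-lowering n i j i<n = begin
      0# * weight j 0 + ∑ n (λ m → motzkin i m * weight j (suc m))
        ≈⟨ +-cong (zeroˡ _) (∑-cong n (λ m → solve 4 (λ x l p y → x :* (l :* p :* y) := x :* (p :* (l :* y))) refl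
                                                       (motzkin i m) Λ (pow Λ m) (motzkin j (suc m)))) ⟩
      0# + ∑ n f
        ≈⟨ trans (+-identityˡ _) (sym (+-identityʳ _)) ⟩
      ∑ n f + 0#
        ≈⟨ +-congˡ (sym (trans (*-congʳ (motzkin-upper i<n)) (zeroˡ _))) ⟩
      ∑ n f + f n
        ≈⟨ sym (∑-last n f) ⟩
      ∑ (suc n) f ∎
      where
      f : ℕ → Carrier
      f m = motzkin i m * (pow Λ m * (Λ * motzkin j (suc m)))

    ∑-raising : ∀ n i j → i ≤ n →
      ∑ (suc n) (λ m → Λ * motzkin i (suc m) * weight j m) ≈ ∑ (suc n) (λ m → motzkin i m * (pow Λ m * motzkin⁻ j m))
    ∑-raising n i j i≤n = begin
      ∑ (suc n) f
        ≈⟨ ∑-last n f ⟩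
      ∑ n f + Λ * motzkin i (suc n) * weight j n
        ≈⟨ +-congˡ (trans (*-congʳ (trans (*-congˡ (motzkin-upper (s≤s i≤n))) (zeroʳ _))) (zeroˡ _)) ⟩
      ∑ n f + 0#
        ≈⟨ +-identityʳ _ ⟩
      ∑ n f
        ≈⟨ ∑-cong n (λ m → solve 4 (λ l x p y → l :* x :* (p :* y) := x :* (l :* p :* y)) refl
                                    Λ (motzkin i (suc m)) (pow Λ m) (motzkin j m)) ⟩
      ∑ n (λ m → motzkin i (suc m) * (pow Λ (suc m) * motzkin⁻ j (suc m)))
        ≈⟨ sym (trans (+-congʳ (trans (*-congˡ (zeroʳ _)) (zeroʳ _))) (+-identityˡ _)) ⟩
      motzkin i 0 * (pow Λ 0 * motzkin⁻ j 0) + ∑ n (λ m → motzkin i (suc m) * (pow Λ (suc m) * motzkin⁻ j (suc m))) ∎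
      where
      f : ℕ → Carrier
      f m = Λ * motzkin i (suc m) * weight j m

    -- The Jacobi matrix is self-adjoint for the weights Λᵐ.
    jacobi-symmetric : ∀ n i j → i < n →
      ∑ (suc n) (λ m → motzkin (suc i) m * weight j m) ≈ ∑ (suc n) (λ m → motzkin i m * weight (suc j) m)
    jacobi-symmetric n i j i<n = begin
      ∑ (suc n) (λ m → motzkin (suc i) m * weight j m)
        ≈⟨ ∑-cong (suc n) (λ m → trans (*-congʳ {weight j m} (motzkin-suc i m)) (trans (distribʳ _ _ _) (+-congʳ (distribʳ _ _ _)))) ⟩
      ∑ (suc n) (λ m → lowered m + levelled m + raised m)
        ≈⟨ trans (∑-+ (suc n) (λ m → lowered m + levelled m) raised) (+-congʳ (∑-+ (suc n) lowered levelled)) ⟩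
      ∑ (suc n) lowered + ∑ (suc n) levelled + ∑ (suc n) raised
        ≈⟨ +-cong (+-cong (∑-lowering n i j i<n) (∑-cong (suc n) reorder)) (∑-raising n i j (ℕ.<⇒≤ i<n)) ⟩
      ∑ (suc n) lowered′ + ∑ (suc n) levelled′ + ∑ (suc n) raised′
        ≈⟨ sym (trans (∑-+ (suc n) (λ m → lowered′ m + levelled′ m) raised′) (+-congʳ (∑-+ (suc n) lowered′ levelled′))) ⟩
      ∑ (suc n) (λ m → lowered′ m + levelled′ m + raised′ m)
        ≈⟨ ∑-cong (suc n) (λ m → trans (solve 5 (λ x p a b c → x :* (p :* a) :+ x :* (p :* b) :+ x :* (p :* c) := x :* (p :* (c :+ b :+ a)))
                                                refl (motzkin i m) (pow Λ m) (Λ * motzkin j (suc m)) (b m * motzkin j m) (motzkin⁻ j m))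
                                         (*-congˡ (*-congˡ (sym (motzkin-suc j m))))) ⟩
      ∑ (suc n) (λ m → motzkin i m * weight (suc j) m) ∎
      where
      lowered levelled raised lowered′ levelled′ raised′ : ℕ → Carrier
      lowered m   = motzkin⁻ i m * weight j m
      levelled m  = b m * motzkin i m * weight j m
      raised m    = Λ * motzkin i (suc m) * weight j m
      lowered′ m  = motzkin i m * (pow Λ m * (Λ * motzkin j (suc m)))
      levelled′ m = motzkin i m * (pow Λ m * (b m * motzkin j m))
      raised′ m   = motzkin i m * (pow Λ m * motzkin⁻ j m)
      reorder : ∀ m → levelled m ≈ levelled′ m
      reorder m = solve 4 (λ β x p y → β :* x :* (p :* y) := x :* (p :* (β :* y))) refl (b m) (motzkin i m) (pow Λ m) (motzkin j m)

    hankel-factorisation : ∀ n i → i ≤ n → ∀ j → ∑ (suc n) (λ m → motzkin i m * weight j m) ≈ μ (i ℕ.+ j)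
    hankel-factorisation n zero    _       j = begin
      1# * (1# * motzkin j 0) + ∑ n (λ m → 0# * weight j (suc m))
        ≈⟨ +-cong (trans (*-identityˡ _) (*-identityˡ _)) (∑-zero n (λ m → zeroˡ _)) ⟩
      motzkin j 0 + 0#
        ≈⟨ trans (+-identityʳ _) (motzkin≈μ j) ⟩
      μ j ∎
    hankel-factorisation n (suc i) 1+i≤n j = begin
      ∑ (suc n) (λ m → motzkin (suc i) m * weight j m)  ≈⟨ jacobi-symmetric n i j 1+i≤n ⟩
      ∑ (suc n) (λ m → motzkin i m * weight (suc j) m)  ≈⟨ hankel-factorisation n i (ℕ.<⇒≤ 1+i≤n) (suc j) ⟩
      μ (i ℕ.+ suc j)                                   ≡⟨ ≡.cong μ (ℕ.+-suc i j) ⟩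
      μ (suc i ℕ.+ j)                                   ∎

theorem6p15 : {c ℓ : Level} (F : Field c ℓ) →
    let open Field F
        open FieldDefs F
    in (A B C : Carrier) → (A≉0 : ¬ (A ≈ 0#)) →
       (∀ n → 1 ≤ n → ¬ (eval (Setting.Pol A B C n) (- (C * inv A A≉0)) ≈ 0#)) →
       (L : ℕ → ℕ → Carrier) → Setting.IsMomentFunctional A B C L →
       (n : ℕ) →
       det (suc n) (hankel (Setting.moment A B C L) n)
         ≈ pow (A * A + A * B + C) (suc n choose 2)
-- The hypothesis P_n(−C/A) ≠ 0 only guarantees that 𝓛 exists.
theorem6p15 F A B C A≉0 _ L isMomentFunctional n = begin
  det (suc n) (hankel μ n)
    ≈⟨ det-unitLowerTriangular-* n T U (hankel μ n) (λ _ _ → motzkin-upper) (λ i → motzkin-diagonal (toℕ i)) entries ⟩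
  det (suc n) U
    ≈⟨ det-upperTriangular n U (pow Λ) (λ _ _ j<i → trans (*-congˡ (motzkin-upper j<i)) (zeroʳ _))
                                       (λ i → trans (*-congˡ (motzkin-diagonal (toℕ i))) (*-identityʳ _)) ⟩
  ∏ (suc n) (pow Λ)
    ≈⟨ ∏-pow Λ (suc n) ⟩
  pow Λ (suc n choose 2) ∎
  where
  open Field F hiding (zero)
  open FieldDefs F
  open Sums F using (∏; ∏-pow; sumFin≈∑)
  open Determinants F using (Matrix; det-unitLowerTriangular-*; det-upperTriangular)
  open Moments F A B C A≉0 L isMomentFunctional
  open Recurrences using (Λ; motzkin; motzkin-upper; motzkin-diagonal)
  open Factorisation using (weight; hankel-factorisation)
  open import Relation.Binary.Reasoning.Setoid setoid
  T U : Matrix (suc n)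
  T i m = motzkin (toℕ i) (toℕ m)
  U m j = weight (toℕ j) (toℕ m)
  entries : ∀ i j → hankel μ n i j ≈ sumFin (suc n) (λ m → T i m * U m j)
  entries i j = sym (trans (sumFin≈∑ (suc n) (λ m → motzkin (toℕ i) m * weight (toℕ j) m))
                           (hankel-factorisation n (toℕ i) (toℕ≤pred[n] i) (toℕ j)))
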